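{- For every $d\in\mathbb N$, the family of graphs with maximal degree $d$ has a labeling scheme (in the adversarial model described in the context) with labels of size $O(d\log d)$ bits and probability of forgery at most $1/2$.
   Context: A labeling scheme (adjacency sketch) for a family of graphs consists of a randomized encoder that, given a graph $G$ in the family, outputs a labeling $\ell:V(G)\to\{0,1\}^c$ ($c$ is the size), and a deterministic decoder $\mathcal D:\{0,1\}^*\times\{0,1\}^*\to\{0,1\}$; the scheme errs only on non-edges, i.e. $\mathcal D(\ell(u),\ell(v))=1$ always holds for edges $(u,v)$. Adversarial game: the adversary chooses $G$ in the family with $n$ vertices; labels are drawn by the encoder; the (computationally unbounded) adversary adaptively requests the labels of vertices $x_1,\dots,x_k$, $k\le n-2$, each choice possibly depending on earlier answers; it then names two distinct vertices $x_{k+1},x_{k+2}$ not previously queried. It wins if $(x_{k+1},x_{k+2})\notin E(G)$ but $\mathcal D(\ell(x_{k+1}),\ell(x_{k+2}))=1$. The probability of forgery is the maximum over adversaries of the winning probability. -}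

module Defs where

open import Data.Nat using (ℕ; zero; suc; _+_; _*_; _≤_; _≤ᵇ_)
open import Data.Nat.Logarithm using (⌈log₂_⌉)
open import Data.Bool using (Bool; true; false; _∧_; not; if_then_else_)
open import Data.Fin using (Fin; zero; suc)
open import Data.Fin.Properties using (_≟_)
open import Data.Vec using (Vec)
open import Data.List using (List; []; _∷_; length)
open import Data.Bool.ListAction using (any)
open import Data.Product using (_×_; _,_; Σ; ∃; ∃-syntax)
open import Relation.Nullary.Decidable using (⌊_⌋)
open import Relation.Binary.PropositionalEquality using (_≡_; _≢_)

countᶠ : ∀ {m} → (Fin m → Bool) → ℕ
countᶠ {zero}  p = 0
countᶠ {suc m} p = (if p zero then 1 else 0) + countᶠ (λ i → p (suc i))

record Graph (n : ℕ) : Set where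
  field
    adj   : Fin n → Fin n → Bool
    sym   : ∀ u v → adj u v ≡ adj v u
    irrefl : ∀ v → adj v v ≡ false
open Graph public

degree : ∀ {n} → Graph n → Fin n → ℕ
degree G v = countᶠ (adj G v)

MaxDeg≤ : ∀ {n} → ℕ → Graph n → Set
MaxDeg≤ d G = ∀ v → degree G v ≤ d

Label : ℕ → Set
Label c = Vec Bool c

-- Randomized encoder with label size c: for each graph G on n vertices,
-- a finite uniform probability space of (suc (seeds G)) random seeds and,
-- for each seed, a labeling of the vertices.
record Encoder (c : ℕ) : Set where
  field
    seeds    : ∀ {n} → Graph n → ℕ
    labeling : ∀ {n} (G : Graph n) → Fin (suc (seeds G)) → Fin n → Label c
open Encoder public

Decoder : ℕ → Set
Decoder c = Label c → Label c → Bool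

-- Adaptive adversary (computationally unbounded): a decision tree.
-- 'query x k' asks for the label of x and continues with k applied to the answer;
-- 'guess x y' ends the game naming the pair (x , y).
data Adversary (n c : ℕ) : Set where
  guess : Fin n → Fin n → Adversary n c
  query : Fin n → (Label c → Adversary n c) → Adversary n c

run : ∀ {n c} → (Fin n → Label c) → Adversary n c → List (Fin n) × (Fin n × Fin n)
run ℓ (guess x y) = [] , (x , y)
run ℓ (query x k) with run ℓ (k (ℓ x))
... | qs , p = (x ∷ qs) , p

_∈ᵇ_ : ∀ {n} → Fin n → List (Fin n) → Bool
x ∈ᵇ qs = any (λ q → ⌊ x ≟ q ⌋) qs

wins : ∀ {n c} → Graph n → Decoder c → (Fin n → Label c) → Adversary n c → Bool
wins {n} G D ℓ A with run ℓ A
... | qs , (x , y) =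
  ((length qs + 2) ≤ᵇ n) ∧ not ⌊ x ≟ y ⌋ ∧ not (x ∈ᵇ qs) ∧ not (y ∈ᵇ qs)
  ∧ not (adj G x y) ∧ D (ℓ x) (ℓ y)

record Scheme (d c : ℕ) : Set where
  field
    enc : Encoder c
    dec : Decoder c
    complete : ∀ {n} (G : Graph n) → MaxDeg≤ d G →
               ∀ s u v → adj G u v ≡ true →
               dec (labeling enc G s u) (labeling enc G s v) ≡ true
    -- forgery probability ≤ 1/2:  #winning seeds / #seeds ≤ 1/2
    forgery : ∀ {n} (G : Graph n) → MaxDeg≤ d G → (A : Adversary n c) →
              2 * countᶠ (λ s → wins G dec (labeling enc G s) A)
                ≤ suc (seeds enc G)

-- Every vertex gets a column of r = 2M colours out of M = 4d + 1, drawn uniformly among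
-- the colourings in which adjacent vertices differ in every coordinate; a label is the binary code of
-- the column, and the decoder accepts a pair iff the two columns differ everywhere, so edges are never
-- missed. For the forgery bound, group the seeds by the adversary's final guess (x , y) and the
-- colouring off {x , y}. Inside a group the run is fixed, and since x and y are not adjacent the group
-- is a product over coordinates of the pairs of colours allowed at x and at y. At most d colours are
-- forbidden on each side, so with 4d ≤ M the two colours coincide with probability at least 1/(2M) in
-- every coordinate, and the adversary wins with probability at most (1 - 1/(2M))^(2M) ≤ 1/2.

module Submission where

open import Defs hiding (sym)
open import Data.Nat using (ℕ; zero; suc; _+_; _*_; _^_; _∸_; _≤_; _<_; _≤ᵇ_; _<ᵇ_; z≤n; s≤s; ⌊_/2⌋; ⌈_/2⌉)
open import Data.Nat.Properties hiding (_≟_)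
open import Data.Nat.Induction using (<-rec)
open import Data.Nat.Logarithm using (⌈log₂_⌉; ⌈log₂⌈n/2⌉⌉≡⌈log₂n⌉∸1; ⌈log₂⌉-mono-≤; ⌈log₂2^n⌉≡n)
open import Data.Nat.Tactic.RingSolver using (solve-∀)
open import Data.Bool using (Bool; true; false; _∧_; _∨_; not; if_then_else_)
open import Data.Bool.Properties
  using (∧-conicalˡ; ∧-conicalʳ; ∧-identityʳ; ∧-zeroʳ; ∧-assoc; ∨-zeroʳ; if-∧; not-involutive; T-≡)
import Data.Bool.Properties as Bool
open import Data.Empty using (⊥; ⊥-elim)
open import Data.Fin using (Fin; zero; suc; toℕ; fromℕ<)
open import Data.Fin.Properties using (_≟_; 2↔Bool; inject≤-injective; toℕ-injective; toℕ-fromℕ<; toℕ<n)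
open import Data.List using (List; []; _∷_; _++_; concatMap; length; allFin; filterᵇ)
import Data.List as List
open import Data.List.Properties using (length-tabulate; map-tabulate; length-filter)
open import Data.Product using (∃; ∃-syntax; _×_; _,_; proj₁; proj₂)
import Data.Product.Properties as Product
open import Data.Sum using (_⊎_; inj₁; inj₂)
open import Data.Vec using (Vec; []; _∷_; lookup; replicate; tabulate; _[_]≔_; concat; group)
import Data.Vec as Vec
open import Data.Vec.Properties
  using (≡-dec; lookup∘update; lookup∘update′; lookup-replicate; lookup∘tabulate; tabulate∘lookup; tabulate-cong;
         lookup-map; ++-injectiveˡ; ++-injectiveʳ; ∷-injective)
open import Data.Vec.Recursive using (Fin[m^n]↔Fin[m]^n)
open import Data.Vec.Recursive.Properties using (↔Vec)
open import Function using (_∘_; const; id; _↣_; mk↣; Injection; Equivalence)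
open import Function.Construct.Composition using (_↣-∘_; _↔-∘_)
open import Function.Properties.Inverse using (↔⇒↣)
open import Relation.Binary.Definitions using (DecidableEquality)
open import Relation.Binary.PropositionalEquality
open import Relation.Nullary using (Dec; yes; no)
open import Relation.Nullary.Decidable using (⌊_⌋; does; dec-true; dec-false; isYes≗does; T?)

private variable
  A B : Set
  n m r w c d : ℕ

-- Defined by if_then_else_ so that counting over allFin unfolds exactly like countᶠ.
⟦_⟧ : Bool → ℕ
⟦ b ⟧ = if b then 1 else 0

⟦∧⟧ : ∀ a b → ⟦ a ∧ b ⟧ ≡ ⟦ a ⟧ * ⟦ b ⟧
⟦∧⟧ true  b = sym (+-identityʳ ⟦ b ⟧)
⟦∧⟧ false b = refl

⟦∧⟧-if : ∀ a b → ⟦ a ∧ b ⟧ ≡ (if b then ⟦ a ⟧ else 0)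
⟦∧⟧-if a true  = cong ⟦_⟧ (∧-identityʳ a)
⟦∧⟧-if a false = cong ⟦_⟧ (∧-zeroʳ a)

⟦⟧≤1 : ∀ b → ⟦ b ⟧ ≤ 1
⟦⟧≤1 true  = ≤-refl
⟦⟧≤1 false = z≤n

does-sound : ∀ {P : Set} (p? : Dec P) → does p? ≡ true → P
does-sound (yes p) _ = p

conflict : ∀ {b} → b ≡ false → b ≡ true → ⊥
conflict refl ()

true-iff : ∀ {a b : Bool} → (a ≡ true → b ≡ true) → (b ≡ true → a ≡ true) → a ≡ b
true-iff {true}  {true}  _ _ = refl
true-iff {true}  {false} f _ = sym (f refl)
true-iff {false} {true}  _ g = g refl
true-iff {false} {false} _ _ = refl

does-≟-sym : (_≟A_ : DecidableEquality A) (a b : A) → does (a ≟A b) ≡ does (b ≟A a)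
does-≟-sym _≟A_ a b with a ≟A b
... | yes a≡b = sym (dec-true (b ≟A a) (sym a≡b))
... | no a≢b  = sym (dec-false (b ≟A a) (a≢b ∘ sym))

allᶠ : ∀ {r} → (Fin r → Bool) → Bool
allᶠ {zero}  p = true
allᶠ {suc r} p = p zero ∧ allᶠ (p ∘ suc)

allᶠ-elim : ∀ {r} (p : Fin r → Bool) → allᶠ p ≡ true → ∀ i → p i ≡ true
allᶠ-elim p h zero    = ∧-conicalˡ (p zero) _ h
allᶠ-elim p h (suc i) = allᶠ-elim (p ∘ suc) (∧-conicalʳ (p zero) _ h) i

allᶠ-intro : ∀ {r} (p : Fin r → Bool) → (∀ i → p i ≡ true) → allᶠ p ≡ true
allᶠ-intro {zero}  p h = refl
allᶠ-intro {suc r} p h rewrite h zero = allᶠ-intro (p ∘ suc) (h ∘ suc)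

allᶠ-∧ : ∀ {r} (p q : Fin r → Bool) → allᶠ p ∧ allᶠ q ≡ allᶠ (λ i → p i ∧ q i)
allᶠ-∧ {zero}  p q = refl
allᶠ-∧ {suc r} p q with p zero | q zero
... | true  | true  = allᶠ-∧ (p ∘ suc) (q ∘ suc)
... | true  | false = ∧-zeroʳ (allᶠ (p ∘ suc))
... | false | _     = refl

allᶠ-cong : ∀ {r} {p q : Fin r → Bool} → (∀ i → p i ≡ q i) → allᶠ p ≡ allᶠ q
allᶠ-cong {zero}  e = refl
allᶠ-cong {suc r} e = cong₂ _∧_ (e zero) (allᶠ-cong (e ∘ suc))

countᶠ-mono : ∀ {m} {p q : Fin m → Bool} → (∀ i → p i ≡ true → q i ≡ true) → countᶠ p ≤ countᶠ q
countᶠ-mono {zero}          _   = z≤n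
countᶠ-mono {suc m} {p} {q} p⇒q with p zero in p0 | q zero in q0
... | true  | true  = s≤s (countᶠ-mono (p⇒q ∘ suc))
... | true  | false = ⊥-elim (conflict q0 (p⇒q zero p0))
... | false | true  = m≤n⇒m≤1+n (countᶠ-mono (p⇒q ∘ suc))
... | false | false = countᶠ-mono (p⇒q ∘ suc)

countᶠ-witness : (p : Fin m → Bool) → 0 < countᶠ p → ∃ λ i → p i ≡ true
countᶠ-witness {suc m} p pos with p zero in p0
... | true  = zero , p0
... | false = let i , pi = countᶠ-witness (p ∘ suc) pos in suc i , pi

countᶠ-not+countᶠ : (p : Fin m → Bool) → countᶠ (not ∘ p) + countᶠ p ≡ m
countᶠ-not+countᶠ {zero}  p = refl
countᶠ-not+countᶠ {suc m} p with p zero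
... | true  = trans (+-suc _ _) (cong suc (countᶠ-not+countᶠ (p ∘ suc)))
... | false = cong suc (countᶠ-not+countᶠ (p ∘ suc))

∑ : List A → (A → ℕ) → ℕ
∑ []       f = 0
∑ (x ∷ xs) f = f x + ∑ xs f

syntax ∑ L (λ x → f) = ∑[ x ∈ L ] f

count : (A → Bool) → List A → ℕ
count p L = ∑[ x ∈ L ] ⟦ p x ⟧

∑-cong : (L : List A) {f g : A → ℕ} → (∀ x → f x ≡ g x) → ∑ L f ≡ ∑ L g
∑-cong []      e = refl
∑-cong (x ∷ L) e = cong₂ _+_ (e x) (∑-cong L e)

∑-mono-≤ : (L : List A) {f g : A → ℕ} → (∀ x → f x ≤ g x) → ∑ L f ≤ ∑ L g
∑-mono-≤ []      e = z≤n
∑-mono-≤ (x ∷ L) e = +-mono-≤ (e x) (∑-mono-≤ L e)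

∑-zero : (L : List A) → ∑[ x ∈ L ] 0 ≡ 0
∑-zero []      = refl
∑-zero (x ∷ L) = ∑-zero L

∑-const : (L : List A) (k : ℕ) → ∑[ x ∈ L ] k ≡ length L * k
∑-const []      k = refl
∑-const (x ∷ L) k = cong (k +_) (∑-const L k)

∑-distrib-+ : (L : List A) (f g : A → ℕ) → ∑[ x ∈ L ] (f x + g x) ≡ ∑ L f + ∑ L g
∑-distrib-+ []      f g = refl
∑-distrib-+ (x ∷ L) f g = begin
  f x + g x + ∑[ y ∈ L ] (f y + g y) ≡⟨ cong (f x + g x +_) (∑-distrib-+ L f g) ⟩
  f x + g x + (∑ L f + ∑ L g)        ≡⟨ +-assoc (f x) (g x) _ ⟩
  f x + (g x + (∑ L f + ∑ L g))      ≡⟨ cong (f x +_) (x+[y+z]≡y+[x+z] (g x) (∑ L f) (∑ L g)) ⟩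
  f x + (∑ L f + (g x + ∑ L g))      ≡⟨ +-assoc (f x) (∑ L f) _ ⟨
  f x + ∑ L f + (g x + ∑ L g)        ∎
  where
  open ≡-Reasoning
  x+[y+z]≡y+[x+z] : ∀ a b c → a + (b + c) ≡ b + (a + c)
  x+[y+z]≡y+[x+z] a b c = trans (sym (+-assoc a b c)) (trans (cong (_+ c) (+-comm a b)) (+-assoc b a c))

∑-distribˡ-* : (L : List A) (k : ℕ) (f : A → ℕ) → ∑[ x ∈ L ] (k * f x) ≡ k * ∑ L f
∑-distribˡ-* []      k f = sym (*-zeroʳ k)
∑-distribˡ-* (x ∷ L) k f = trans (cong (k * f x +_) (∑-distribˡ-* L k f)) (sym (*-distribˡ-+ k (f x) (∑ L f)))

∑-distribʳ-* : (L : List A) (k : ℕ) (f : A → ℕ) → ∑[ x ∈ L ] (f x * k) ≡ ∑ L f * k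
∑-distribʳ-* L k f = trans (∑-cong L (λ x → *-comm (f x) k)) (trans (∑-distribˡ-* L k f) (*-comm k (∑ L f)))

∑-if : (L : List A) (b : Bool) (f : A → ℕ) → ∑[ x ∈ L ] (if b then f x else 0) ≡ (if b then ∑ L f else 0)
∑-if L true  f = refl
∑-if L false f = ∑-zero L

∑-++ : (L M : List A) (f : A → ℕ) → ∑ (L ++ M) f ≡ ∑ L f + ∑ M f
∑-++ []      M f = refl
∑-++ (x ∷ L) M f = trans (cong (f x +_) (∑-++ L M f)) (sym (+-assoc (f x) (∑ L f) (∑ M f)))

∑-map : (g : A → B) (L : List A) (f : B → ℕ) → ∑ (List.map g L) f ≡ ∑[ x ∈ L ] f (g x)
∑-map g []      f = refl
∑-map g (x ∷ L) f = cong (f (g x) +_) (∑-map g L f)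

∑-concatMap : (g : A → List B) (L : List A) (f : B → ℕ) → ∑ (concatMap g L) f ≡ ∑[ x ∈ L ] ∑ (g x) f
∑-concatMap g []      f = refl
∑-concatMap g (x ∷ L) f = trans (∑-++ (g x) (concatMap g L) f) (cong (∑ (g x) f +_) (∑-concatMap g L f))

∑-comm : (L : List A) (M : List B) (f : A → B → ℕ) → ∑[ a ∈ L ] ∑[ b ∈ M ] f a b ≡ ∑[ b ∈ M ] ∑[ a ∈ L ] f a b
∑-comm []      M f = sym (∑-zero M)
∑-comm (a ∷ L) M f = trans (cong (∑ M (f a) +_) (∑-comm L M f)) (sym (∑-distrib-+ M (f a) (λ b → ∑[ a′ ∈ L ] f a′ b)))

∑-allFin-suc : ∀ m (f : Fin (suc m) → ℕ) → ∑ (allFin (suc m)) f ≡ f zero + ∑[ i ∈ allFin m ] f (suc i)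
∑-allFin-suc m f = trans (cong (λ L → f zero + ∑ L f) (sym (map-tabulate id suc))) (cong (f zero +_) (∑-map suc (allFin m) f))

count-allFin : ∀ m (p : Fin m → Bool) → count p (allFin m) ≡ countᶠ p
count-allFin zero    p = refl
count-allFin (suc m) p = trans (∑-allFin-suc m (λ i → ⟦ p i ⟧)) (cong (⟦ p zero ⟧ +_) (count-allFin m (p ∘ suc)))

∑-allFin-const : ∀ m k → ∑[ i ∈ allFin m ] k ≡ m * k
∑-allFin-const m k = trans (∑-const (allFin m) k) (cong (_* k) (length-tabulate {n = m} id))

allVecs : ∀ r → List A → List (Vec A r)
allVecs zero    E = [] ∷ []
allVecs (suc r) E = concatMap (λ c → List.map (c ∷_) (allVecs r E)) E

∑-allVecs-suc : ∀ r (E : List A) (f : Vec A (suc r) → ℕ) →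
                ∑ (allVecs (suc r) E) f ≡ ∑[ c ∈ E ] ∑[ v ∈ allVecs r E ] f (c ∷ v)
∑-allVecs-suc r E f = trans (∑-concatMap _ E f) (∑-cong E (λ c → ∑-map (c ∷_) (allVecs r E) f))

-- E lists every element of A exactly once, stated as the sifting property of the Kronecker delta.
Enumerates : DecidableEquality A → List A → Set
Enumerates {A} _≟A_ E = ∀ (c : A) (f : A → ℕ) → ∑[ e ∈ E ] (if does (e ≟A c) then f e else 0) ≡ f c

allFin-enumerates : ∀ m → Enumerates _≟_ (allFin m)
allFin-enumerates (suc m) zero f =
  trans (∑-allFin-suc m (λ e → if does (e ≟ zero) then f e else 0))
        (trans (cong (f zero +_) (∑-zero (allFin m))) (+-identityʳ (f zero)))
allFin-enumerates (suc m) (suc c) f =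
  trans (∑-allFin-suc m (λ e → if does (e ≟ suc c) then f e else 0)) (allFin-enumerates m c (f ∘ suc))

allVecs-enumerates : (_≟A_ : DecidableEquality A) (E : List A) → Enumerates _≟A_ E →
                     ∀ r → Enumerates (≡-dec {n = r} _≟A_) (allVecs r E)
allVecs-enumerates _≟A_ E enum zero    [] f = +-identityʳ (f [])
allVecs-enumerates _≟A_ E enum (suc r) (c ∷ cs) f = begin
  ∑ (allVecs (suc r) E) (λ v → if does (≡-dec _≟A_ v (c ∷ cs)) then f v else 0)
    ≡⟨ ∑-allVecs-suc r E _ ⟩
  ∑[ e ∈ E ] ∑[ v ∈ allVecs r E ] (if does (e ≟A c) ∧ does (v ≟V cs) then f (e ∷ v) else 0)
    ≡⟨ ∑-cong E (λ e → trans (∑-cong (allVecs r E) (λ v → if-∧ (does (e ≟A c))))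
                             (∑-if (allVecs r E) (does (e ≟A c)) _)) ⟩
  ∑[ e ∈ E ] (if does (e ≟A c) then ∑[ v ∈ allVecs r E ] (if does (v ≟V cs) then f (e ∷ v) else 0) else 0)
    ≡⟨ enum c _ ⟩
  ∑[ v ∈ allVecs r E ] (if does (v ≟V cs) then f (c ∷ v) else 0)
    ≡⟨ allVecs-enumerates _≟A_ E enum r cs (f ∘ (c ∷_)) ⟩
  f (c ∷ cs) ∎
  where
  open ≡-Reasoning
  _≟V_ = ≡-dec _≟A_

length≡count-true : (L : List A) → length L ≡ count (const true) L
length≡count-true L = sym (trans (∑-const L 1) (*-identityʳ (length L)))

count-cong : (L : List A) {p q : A → Bool} → (∀ x → p x ≡ q x) → count p L ≡ count q L
count-cong L e = ∑-cong L (cong ⟦_⟧ ∘ e)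

count-filterᵇ : (q p : A → Bool) (L : List A) → count p (filterᵇ q L) ≡ count (λ y → q y ∧ p y) L
count-filterᵇ q p []      = refl
count-filterᵇ q p (x ∷ L) with q x
... | true  = cong (⟦ p x ⟧ +_) (count-filterᵇ q p L)
... | false = count-filterᵇ q p L

length-filterᵇ : (q : A → Bool) (L : List A) → length (filterᵇ q L) ≡ count q L
length-filterᵇ q L =
  trans (length≡count-true (filterᵇ q L)) (trans (count-filterᵇ q (const true) L) (count-cong L (∧-identityʳ ∘ q)))

count-split : (q p : A → Bool) (L : List A) →
              count p L ≡ count (λ y → p y ∧ q y) L + count (λ y → not (q y) ∧ p y) L
count-split q p L = trans (∑-cong L (λ y → split (p y) (q y))) (∑-distrib-+ L _ _)
  where
  split : ∀ a b → ⟦ a ⟧ ≡ ⟦ a ∧ b ⟧ + ⟦ not b ∧ a ⟧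
  split true  true  = refl
  split true  false = refl
  split false true  = refl
  split false false = refl

length-split : (q : A → Bool) (L : List A) → length L ≡ count q L + length (filterᵇ (not ∘ q) L)
length-split q L = begin
  length L                                         ≡⟨ length≡count-true L ⟩
  count (const true) L                             ≡⟨ count-split q (const true) L ⟩
  count q L + count (λ y → not (q y) ∧ true) L     ≡⟨ cong (count q L +_) (count-filterᵇ (not ∘ q) (const true) L) ⟨
  count q L + count (const true) (filterᵇ (not ∘ q) L) ≡⟨ cong (count q L +_) (length≡count-true (filterᵇ (not ∘ q) L)) ⟨
  count q L + length (filterᵇ (not ∘ q) L)         ∎
  where open ≡-Reasoning

count≡0⊎witness : (p : A → Bool) (L : List A) → count p L ≡ 0 ⊎ ∃ λ x → p x ≡ true
count≡0⊎witness p []      = inj₁ refl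
count≡0⊎witness p (x ∷ L) with p x in px
... | true  = inj₂ (x , px)
... | false = count≡0⊎witness p L

countᶠ-lookup : (p : A → Bool) (L : List A) → countᶠ (p ∘ List.lookup L) ≡ count p L
countᶠ-lookup p []      = refl
countᶠ-lookup p (x ∷ L) = cong (⟦ p x ⟧ +_) (countᶠ-lookup p L)

lookup-filterᵇ : (q : A → Bool) (L : List A) (i : Fin (length (filterᵇ q L))) → q (List.lookup (filterᵇ q L) i) ≡ true
lookup-filterᵇ q (x ∷ L) i with q x in qx
lookup-filterᵇ q (x ∷ L) zero    | true = qx
lookup-filterᵇ q (x ∷ L) (suc i) | true = lookup-filterᵇ q L i
lookup-filterᵇ q (x ∷ L) i       | false = lookup-filterᵇ q L i

-- The default is only returned for the empty list, which never arises for graphs of degree ≤ d.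
pick : (L : List A) → A → Fin (suc (length L ∸ 1)) → A
pick []      a _ = a
pick (x ∷ L) _ s = List.lookup (x ∷ L) s

pick-lookup : (L : List A) (a : A) → 1 ≤ length L → ∀ s → ∃ λ i → pick L a s ≡ List.lookup L i
pick-lookup (x ∷ L) a _ s = s , refl

suc-pred-length : (L : List A) → 1 ≤ length L → suc (length L ∸ 1) ≡ length L
suc-pred-length (x ∷ L) _ = refl

countᶠ-pick : (p : A → Bool) (L : List A) (a : A) → 1 ≤ length L → countᶠ (p ∘ pick L a) ≡ count p L
countᶠ-pick p (x ∷ L) a _ = countᶠ-lookup p (x ∷ L)

module Classes {X K : Set} (_≟K_ : DecidableEquality K) (κ : X → K) where

  _∼ᵇ_ : X → X → Bool
  x ∼ᵇ y = does (κ x ≟K κ y)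

  ∼ᵇ-refl : ∀ x → x ∼ᵇ x ≡ true
  ∼ᵇ-refl x = dec-true (κ x ≟K κ x) refl

  ∼ᵇ-transˡ : ∀ {x y} z → x ∼ᵇ y ≡ true → x ∼ᵇ z ≡ y ∼ᵇ z
  ∼ᵇ-transˡ {x} {y} z x∼y = cong (λ k → does (k ≟K κ z)) (does-sound (κ x ≟K κ y) x∼y)

  ∼ᵇ-transʳ : ∀ {x y} z → x ∼ᵇ y ≡ true → z ∼ᵇ y ≡ z ∼ᵇ x
  ∼ᵇ-transʳ {x} {y} z x∼y = cong (λ k → does (κ z ≟K k)) (sym (does-sound (κ x ≟K κ y) x∼y))

  count-without-class : ∀ x₀ x (L : List X) (p : X → Bool) → (∀ y → p y ≡ true → x ∼ᵇ y ≡ true) →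
    count p (filterᵇ (not ∘ (x₀ ∼ᵇ_)) L) ≡ (if x₀ ∼ᵇ x then 0 else count p L)
  count-without-class x₀ x L p p⊆[x] = trans (count-filterᵇ _ p L) (trans (count-cong L same) (by-cases (x₀ ∼ᵇ x)))
    where
    same : ∀ y → not (x₀ ∼ᵇ y) ∧ p y ≡ not (x₀ ∼ᵇ x) ∧ p y
    same y with p y in py
    ... | true  = cong (λ b → not b ∧ true) (∼ᵇ-transʳ x₀ (p⊆[x] y py))
    ... | false = trans (∧-zeroʳ _) (sym (∧-zeroʳ _))
    by-cases : ∀ b → count (λ y → not b ∧ p y) L ≡ (if b then 0 else count p L)
    by-cases true  = ∑-zero L
    by-cases false = refl

  ClasswiseHalf : (X → Bool) → List X → Set
  ClasswiseHalf W L = ∀ x → 2 * count (λ y → W y ∧ x ∼ᵇ y) L ≤ count (x ∼ᵇ_) L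

  classwise-half⇒half : (W : X → Bool) (L : List X) → ClasswiseHalf W L → 2 * count W L ≤ length L
  classwise-half⇒half W L = go (length L) L ≤-refl
    where
    go : ∀ n L → length L ≤ n → ClasswiseHalf W L → 2 * count W L ≤ length L
    go n       []          _      _ = z≤n
    go (suc n) L@(x₀ ∷ L₀) (s≤s |L₀|≤n) half = begin
      2 * count W L
        ≡⟨ cong (2 *_) (count-split (x₀ ∼ᵇ_) W L) ⟩
      2 * (same-W + count (λ y → not (x₀ ∼ᵇ y) ∧ W y) L)
        ≡⟨ cong (λ c → 2 * (same-W + c)) (count-filterᵇ _ W L) ⟨
      2 * (same-W + count W L′)
        ≡⟨ *-distribˡ-+ 2 same-W (count W L′) ⟩
      2 * same-W + 2 * count W L′
        ≤⟨ +-mono-≤ (half x₀) (go n L′ |L′|≤n half′) ⟩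
      count (x₀ ∼ᵇ_) L + length L′
        ≡⟨ length-split (x₀ ∼ᵇ_) L ⟨
      length L ∎
      where
      open ≤-Reasoning
      same-W = count (λ y → W y ∧ x₀ ∼ᵇ y) L
      L′ = filterᵇ (not ∘ (x₀ ∼ᵇ_)) L
      |L′|≤n : length L′ ≤ n
      |L′|≤n rewrite ∼ᵇ-refl x₀ = ≤-trans (length-filter (T? ∘ (not ∘ (x₀ ∼ᵇ_))) L₀) |L₀|≤n
      half′ : ClasswiseHalf W L′
      half′ x with x₀ ∼ᵇ x | count-without-class x₀ x L (λ y → W y ∧ x ∼ᵇ y) (λ y → ∧-conicalʳ (W y) _)
                                | count-without-class x₀ x L (x ∼ᵇ_) (λ y → id)
      ... | true  | winners | members rewrite winners | members = z≤n
      ... | false | winners | members rewrite winners | members = half x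

∏ᶠ : ∀ {r} → (Fin r → ℕ) → ℕ
∏ᶠ {zero}  f = 1
∏ᶠ {suc r} f = f zero * ∏ᶠ (f ∘ suc)

bernoulli : ∀ a n → a ^ n * (a + n) ≤ suc a ^ n * a
bernoulli a zero    = ≤-reflexive (+-identityʳ (a + 0))
bernoulli a (suc n) = begin
  a * a ^ n * (a + suc n)                      ≡⟨ lhs a (a ^ n) n ⟩
  a ^ n * (a * (a + n) + a)                    ≤⟨ m≤m+n _ (a ^ n * n) ⟩
  a ^ n * (a * (a + n) + a) + a ^ n * n        ≡⟨ rhs a (a ^ n) n ⟨
  suc a * (a ^ n * (a + n))                    ≤⟨ *-monoʳ-≤ (suc a) (bernoulli a n) ⟩
  suc a * (suc a ^ n * a)                      ≡⟨ *-assoc (suc a) (suc a ^ n) a ⟨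
  suc a ^ suc n * a                            ∎
  where
  open ≤-Reasoning
  lhs : ∀ a p n → a * p * (a + suc n) ≡ p * (a * (a + n) + a)
  lhs = solve-∀
  rhs : ∀ a p n → suc a * (p * (a + n)) ≡ p * (a * (a + n) + a) + p * n
  rhs = solve-∀

-- (1 + 1/a)^(a+1) ≥ 2, from Bernoulli's inequality with n = a + 1.
2*n^[1+n]≤[1+n]^[1+n] : ∀ a → 2 * a ^ suc a ≤ suc a ^ suc a
2*n^[1+n]≤[1+n]^[1+n] zero        = z≤n
2*n^[1+n]≤[1+n]^[1+n] a@(suc a-1) = *-cancelˡ-≤ a (begin
  a * (2 * a ^ suc a)           ≡⟨ double a (a ^ suc a) ⟩
  a ^ suc a * (a + a)           ≤⟨ m≤m+n _ (a ^ suc a) ⟩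
  a ^ suc a * (a + a) + a ^ suc a ≡⟨ spread (a ^ suc a) a ⟩
  a ^ suc a * (a + suc a)       ≤⟨ bernoulli a (suc a) ⟩
  suc a ^ suc a * a             ≡⟨ *-comm _ a ⟩
  a * suc a ^ suc a             ∎)
  where
  open ≤-Reasoning
  double : ∀ a p → a * (2 * p) ≡ p * (a + a)
  double = solve-∀
  spread : ∀ p a → p * (a + a) + p ≡ p * (a + suc a)
  spread = solve-∀

∏ᶠ-ratio-≤ : ∀ a r (s t : Fin r → ℕ) → (∀ i → suc a * s i ≤ a * t i) → suc a ^ r * ∏ᶠ s ≤ a ^ r * ∏ᶠ t
∏ᶠ-ratio-≤ a zero    s t h = ≤-refl
∏ᶠ-ratio-≤ a (suc r) s t h = begin
  suc a ^ suc r * (s zero * ∏ᶠ (s ∘ suc))           ≡⟨ interchange (suc a) (suc a ^ r) (s zero) _ ⟩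
  (suc a * s zero) * (suc a ^ r * ∏ᶠ (s ∘ suc))     ≤⟨ *-mono-≤ (h zero) (∏ᶠ-ratio-≤ a r (s ∘ suc) (t ∘ suc) (h ∘ suc)) ⟩
  (a * t zero) * (a ^ r * ∏ᶠ (t ∘ suc))             ≡⟨ interchange a (a ^ r) (t zero) _ ⟨
  a ^ suc r * (t zero * ∏ᶠ (t ∘ suc))               ∎
  where
  open ≤-Reasoning
  interchange : ∀ x y z w → x * y * (z * w) ≡ (x * z) * (y * w)
  interchange = solve-∀

∏ᶠ-half-≤ : ∀ a (s t : Fin (suc a) → ℕ) → (∀ i → suc a * s i ≤ a * t i) → 2 * ∏ᶠ s ≤ ∏ᶠ t
∏ᶠ-half-≤ a s t h = *-cancelˡ-≤ (suc a ^ suc a) {{m^n≢0 (suc a) (suc a)}} (begin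
  suc a ^ suc a * (2 * ∏ᶠ s)   ≡⟨ x*[2*y]≡2*[x*y] (suc a ^ suc a) (∏ᶠ s) ⟩
  2 * (suc a ^ suc a * ∏ᶠ s)   ≤⟨ *-monoʳ-≤ 2 (∏ᶠ-ratio-≤ a (suc a) s t h) ⟩
  2 * (a ^ suc a * ∏ᶠ t)       ≡⟨ *-assoc 2 (a ^ suc a) (∏ᶠ t) ⟨
  2 * a ^ suc a * ∏ᶠ t         ≤⟨ *-monoˡ-≤ (∏ᶠ t) (2*n^[1+n]≤[1+n]^[1+n] a) ⟩
  suc a ^ suc a * ∏ᶠ t         ∎)
  where
  open ≤-Reasoning
  x*[2*y]≡2*[x*y] : ∀ x y → x * (2 * y) ≡ 2 * (x * y)
  x*[2*y]≡2*[x*y] = solve-∀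

count₂ : (A → A → Bool) → List A → ℕ
count₂ P L = ∑[ a ∈ L ] count (P a) L

∑²-factorise : ∀ {B : Set} (E : List A) (V : List B) (f : A → A → ℕ) (g : B → B → ℕ) →
  ∑[ α ∈ E ] ∑[ a ∈ V ] ∑[ β ∈ E ] ∑[ b ∈ V ] (f α β * g a b)
  ≡ (∑[ α ∈ E ] ∑[ β ∈ E ] f α β) * (∑[ a ∈ V ] ∑[ b ∈ V ] g a b)
∑²-factorise E V f g = begin
  ∑[ α ∈ E ] ∑[ a ∈ V ] ∑[ β ∈ E ] ∑[ b ∈ V ] (f α β * g a b)
    ≡⟨ ∑-cong E (λ α → ∑-comm V E _) ⟩
  ∑[ α ∈ E ] ∑[ β ∈ E ] ∑[ a ∈ V ] ∑[ b ∈ V ] (f α β * g a b)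
    ≡⟨ ∑-cong E (λ α → ∑-cong E (λ β →
         trans (∑-cong V (λ a → ∑-distribˡ-* V (f α β) (g a))) (∑-distribˡ-* V (f α β) _))) ⟩
  ∑[ α ∈ E ] ∑[ β ∈ E ] (f α β * G)
    ≡⟨ trans (∑-cong E (λ α → ∑-distribʳ-* E G (f α))) (∑-distribʳ-* E G _) ⟩
  (∑[ α ∈ E ] ∑[ β ∈ E ] f α β) * G ∎
  where
  open ≡-Reasoning
  G = ∑[ a ∈ V ] ∑[ b ∈ V ] g a b

coordinatewise : (Fin r → A → A → Bool) → Vec A r → Vec A r → Bool
coordinatewise P a b = allᶠ (λ i → P i (lookup a i) (lookup b i))

count₂-allVecs : ∀ (E : List A) r (P : Fin r → A → A → Bool) →
                 count₂ (coordinatewise P) (allVecs r E) ≡ ∏ᶠ (λ i → count₂ (P i) E)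
count₂-allVecs E zero    P = refl
count₂-allVecs E (suc r) P = begin
  count₂ (coordinatewise P) (allVecs (suc r) E)
    ≡⟨ ∑-allVecs-suc r E _ ⟩
  ∑[ α ∈ E ] ∑[ a ∈ V ] count (coordinatewise P (α ∷ a)) (allVecs (suc r) E)
    ≡⟨ ∑-cong E (λ α → ∑-cong V (λ a → ∑-allVecs-suc r E _)) ⟩
  ∑[ α ∈ E ] ∑[ a ∈ V ] ∑[ β ∈ E ] ∑[ b ∈ V ] ⟦ P zero α β ∧ coordinatewise (P ∘ suc) a b ⟧
    ≡⟨ ∑-cong E (λ α → ∑-cong V (λ a → ∑-cong E (λ β → ∑-cong V (λ b → ⟦∧⟧ (P zero α β) _)))) ⟩
  ∑[ α ∈ E ] ∑[ a ∈ V ] ∑[ β ∈ E ] ∑[ b ∈ V ] (⟦ P zero α β ⟧ * ⟦ coordinatewise (P ∘ suc) a b ⟧)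
    ≡⟨ ∑²-factorise E V (λ α β → ⟦ P zero α β ⟧) (λ a b → ⟦ coordinatewise (P ∘ suc) a b ⟧) ⟩
  count₂ (P zero) E * count₂ (coordinatewise (P ∘ suc)) V
    ≡⟨ cong (count₂ (P zero) E *_) (count₂-allVecs E r (P ∘ suc)) ⟩
  ∏ᶠ (λ i → count₂ (P i) E) ∎
  where
  open ≡-Reasoning
  V = allVecs r E

count₂-split-diagonal : (_≟A_ : DecidableEquality A) (E : List A) → Enumerates _≟A_ E → (P : A → A → Bool) →
  count₂ P E ≡ count₂ (λ α β → P α β ∧ not (does (α ≟A β))) E + count (λ α → P α α) E
count₂-split-diagonal _≟A_ E enum P = begin
  count₂ P E
    ≡⟨ ∑-cong E (λ α → ∑-cong E (λ β → split (P α β) (does (α ≟A β)))) ⟩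
  ∑[ α ∈ E ] ∑[ β ∈ E ] (⟦ P α β ∧ not (does (α ≟A β)) ⟧ + ⟦ P α β ∧ does (α ≟A β) ⟧)
    ≡⟨ trans (∑-cong E (λ α → ∑-distrib-+ E _ _)) (∑-distrib-+ E _ _) ⟩
  count₂ (λ α β → P α β ∧ not (does (α ≟A β))) E + ∑[ α ∈ E ] count (λ β → P α β ∧ does (α ≟A β)) E
    ≡⟨ cong (count₂ _ E +_) (∑-cong E diagonal) ⟩
  count₂ (λ α β → P α β ∧ not (does (α ≟A β))) E + count (λ α → P α α) E ∎
  where
  open ≡-Reasoning
  split : ∀ x e → ⟦ x ⟧ ≡ ⟦ x ∧ not e ⟧ + ⟦ x ∧ e ⟧
  split true  true  = refl
  split true  false = refl
  split false e     = refl
  diagonal : ∀ α → count (λ β → P α β ∧ does (α ≟A β)) E ≡ ⟦ P α α ⟧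
  diagonal α = trans (∑-cong E (λ β → trans (cong (λ e → ⟦ P α β ∧ e ⟧) (does-≟-sym _≟A_ α β)) (⟦∧⟧-if (P α β) _)))
                     (enum α (λ β → ⟦ P α β ⟧))

length≤count-∧+count-not+count-not : (L : List A) (p q : A → Bool) →
  length L ≤ count (λ x → p x ∧ q x) L + count (not ∘ p) L + count (not ∘ q) L
length≤count-∧+count-not+count-not L p q = begin
  length L                                                    ≡⟨ length≡count-true L ⟩
  ∑[ x ∈ L ] 1                                                ≤⟨ ∑-mono-≤ L (λ x → cover (p x) (q x)) ⟩
  ∑[ x ∈ L ] (⟦ p x ∧ q x ⟧ + ⟦ not (p x) ⟧ + ⟦ not (q x) ⟧)   ≡⟨ ∑-distrib-+ L _ _ ⟩
  ∑[ x ∈ L ] (⟦ p x ∧ q x ⟧ + ⟦ not (p x) ⟧) + count (not ∘ q) L ≡⟨ cong (_+ count (not ∘ q) L) (∑-distrib-+ L _ _) ⟩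
  count (λ x → p x ∧ q x) L + count (not ∘ p) L + count (not ∘ q) L ∎
  where
  open ≤-Reasoning
  cover : ∀ a b → 1 ≤ ⟦ a ∧ b ⟧ + ⟦ not a ⟧ + ⟦ not b ⟧
  cover true  true = ≤-refl
  cover true  false = s≤s z≤n
  cover false b    = s≤s z≤n

_≢ᵇ_ : ∀ {m} → Fin m → Fin m → Bool
α ≢ᵇ β = not (does (α ≟ β))

-- With at most d of the M = m + 1 colours forbidden on each side and 4d ≤ M, at least M/2 colours
-- are allowed on both sides, so a compatible pair of colours is equal with probability ≥ 1/(2M).
distinct-pairs-ratio : ∀ {m d} (A B : Fin (suc m) → Bool) → countᶠ (not ∘ A) ≤ d → countᶠ (not ∘ B) ≤ d →
  4 * d ≤ suc m →
  suc (suc m + m) * count₂ (λ α β → (A α ∧ B β) ∧ α ≢ᵇ β) (allFin (suc m))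
    ≤ (suc m + m) * count₂ (λ α β → A α ∧ B β) (allFin (suc m))
distinct-pairs-ratio {m} {d} A B A-large B-large 4d≤M = +-cancelʳ-≤ tot _ _ (begin
  suc (M + m) * distinct + tot              ≤⟨ +-monoʳ-≤ _ tot≤M*M ⟩
  suc (M + m) * distinct + M * M            ≤⟨ +-monoʳ-≤ _ (*-monoʳ-≤ M M≤2*diagonal) ⟩
  suc (M + m) * distinct + M * (2 * diagonal) ≡⟨ regroup m distinct diagonal ⟩
  suc (M + m) * (distinct + diagonal)       ≡⟨ cong (suc (M + m) *_) tot≡distinct+diagonal ⟨
  suc (M + m) * tot                         ≡⟨ +-comm tot _ ⟩
  (M + m) * tot + tot                       ∎)
  where
  open ≤-Reasoning
  M = suc m
  E = allFin M
  tot = count₂ (λ α β → A α ∧ B β) E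
  distinct = count₂ (λ α β → (A α ∧ B β) ∧ α ≢ᵇ β) E
  diagonal = count (λ α → A α ∧ B α) E

  tot≡distinct+diagonal : tot ≡ distinct + diagonal
  tot≡distinct+diagonal = count₂-split-diagonal _≟_ E (allFin-enumerates M) (λ α β → A α ∧ B β)

  tot≤M*M : tot ≤ M * M
  tot≤M*M = begin
    tot                          ≤⟨ ∑-mono-≤ E (λ α → ∑-mono-≤ E (λ β → ⟦⟧≤1 (A α ∧ B β))) ⟩
    ∑[ α ∈ E ] ∑[ β ∈ E ] 1      ≡⟨ trans (∑-cong E (λ α → ∑-allFin-const M 1)) (∑-allFin-const M (M * 1)) ⟩
    M * (M * 1)                  ≡⟨ cong (M *_) (*-identityʳ M) ⟩
    M * M                        ∎

  M≤diagonal+2d : M ≤ diagonal + (d + d)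
  M≤diagonal+2d = begin
    M                                                            ≡⟨ length-tabulate {n = M} id ⟨
    length E                                                     ≤⟨ length≤count-∧+count-not+count-not E A B ⟩
    diagonal + count (not ∘ A) E + count (not ∘ B) E
      ≡⟨ cong₂ (λ a b → diagonal + a + b) (count-allFin M (not ∘ A)) (count-allFin M (not ∘ B)) ⟩
    diagonal + countᶠ (not ∘ A) + countᶠ (not ∘ B)               ≤⟨ +-mono-≤ (+-monoʳ-≤ diagonal A-large) B-large ⟩
    diagonal + d + d                                             ≡⟨ +-assoc diagonal d d ⟩
    diagonal + (d + d)                                           ∎

  M≤2*diagonal : M ≤ 2 * diagonal
  M≤2*diagonal = +-cancelʳ-≤ M M (2 * diagonal) (begin
    M + M                                        ≤⟨ +-mono-≤ M≤diagonal+2d M≤diagonal+2d ⟩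
    diagonal + (d + d) + (diagonal + (d + d))    ≡⟨ regroup′ diagonal d ⟩
    2 * diagonal + 4 * d                         ≤⟨ +-monoʳ-≤ (2 * diagonal) 4d≤M ⟩
    2 * diagonal + M                             ∎)
    where
    regroup′ : ∀ x d → x + (d + d) + (x + (d + d)) ≡ 2 * x + 4 * d
    regroup′ = solve-∀

  regroup : ∀ m n q → suc (suc m + m) * n + suc m * (2 * q) ≡ suc (suc m + m) * (n + q)
  regroup = solve-∀

-- Over 2M coordinates the per-coordinate ratios 1 - 1/(2M) multiply to at most 1/2.
distinct-everywhere-at-most-half : ∀ {m d} (A B : Fin (suc (suc m + m)) → Fin (suc m) → Bool) →
  (∀ i → countᶠ (not ∘ A i) ≤ d) → (∀ i → countᶠ (not ∘ B i) ≤ d) → 4 * d ≤ suc m →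
  let V = allVecs (suc (suc m + m)) (allFin (suc m)) in
  2 * count₂ (coordinatewise (λ i α β → (A i α ∧ B i β) ∧ α ≢ᵇ β)) V
    ≤ count₂ (coordinatewise (λ i α β → A i α ∧ B i β)) V
distinct-everywhere-at-most-half {m} A B A-large B-large 4d≤M
  rewrite count₂-allVecs (allFin (suc m)) (suc (suc m + m)) (λ i α β → (A i α ∧ B i β) ∧ α ≢ᵇ β)
        | count₂-allVecs (allFin (suc m)) (suc (suc m + m)) (λ i α β → A i α ∧ B i β)
  = ∏ᶠ-half-≤ (suc m + m) (λ i → count₂ (λ α β → (A i α ∧ B i β) ∧ α ≢ᵇ β) (allFin (suc m)))
                           (λ i → count₂ (λ α β → A i α ∧ B i β) (allFin (suc m)))
                           (λ i → distinct-pairs-ratio (A i) (B i) (A-large i) (B-large i) 4d≤M)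

lookup-injective : (xs ys : Vec A n) → (∀ i → lookup xs i ≡ lookup ys i) → xs ≡ ys
lookup-injective xs ys eq = trans (sym (tabulate∘lookup xs)) (trans (tabulate-cong eq) (tabulate∘lookup ys))

module Fibres {X : Set} (_≟X_ : DecidableEquality X) (E : List X) (enum : Enumerates _≟X_ E) (c₀ : X) where

  _≟V_ : DecidableEquality (Vec X n)
  _≟V_ = ≡-dec _≟X_

  erase₁ : Fin n → Vec X n → Vec X n
  erase₁ x φ = φ [ x ]≔ c₀

  erase₂ : Fin n → Fin n → Vec X n → Vec X n
  erase₂ x y φ = erase₁ y (erase₁ x φ)

  lookup-erase₁ : ∀ {x j} → j ≢ x → (φ : Vec X n) → lookup (erase₁ x φ) j ≡ lookup φ j
  lookup-erase₁ j≢x φ = lookup∘update′ j≢x φ c₀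

  lookup-erase₂ : ∀ {x y j} → j ≢ x → j ≢ y → (φ : Vec X n) → lookup (erase₂ x y φ) j ≡ lookup φ j
  lookup-erase₂ {x = x} j≢x j≢y φ = trans (lookup-erase₁ j≢y (erase₁ x φ)) (lookup-erase₁ j≢x φ)

  erase₁-≡⇒agree : ∀ x (φ ψ : Vec X n) → erase₁ x φ ≡ erase₁ x ψ → ∀ j → j ≢ x → lookup φ j ≡ lookup ψ j
  erase₁-≡⇒agree x φ ψ eq j j≢x =
    trans (sym (lookup-erase₁ j≢x φ)) (trans (cong (λ v → lookup v j) eq) (lookup-erase₁ j≢x ψ))

  agree⇒erase₁-≡ : ∀ x (φ ψ : Vec X n) → (∀ j → j ≢ x → lookup φ j ≡ lookup ψ j) → erase₁ x φ ≡ erase₁ x ψ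
  agree⇒erase₁-≡ x φ ψ agree = lookup-injective _ _ pointwise
    where
    pointwise : ∀ j → lookup (erase₁ x φ) j ≡ lookup (erase₁ x ψ) j
    pointwise j with j ≟ x
    ... | yes refl = trans (lookup∘update j φ c₀) (sym (lookup∘update j ψ c₀))
    ... | no j≢x   = trans (lookup-erase₁ j≢x φ) (trans (agree j j≢x) (sym (lookup-erase₁ j≢x ψ)))

  erase₂-≡⇒agree : ∀ x y (φ ψ : Vec X n) → erase₂ x y φ ≡ erase₂ x y ψ →
                   ∀ j → j ≢ x → j ≢ y → lookup φ j ≡ lookup ψ j
  erase₂-≡⇒agree x y φ ψ eq j j≢x j≢y =
    trans (sym (lookup-erase₂ j≢x j≢y φ)) (trans (cong (λ v → lookup v j) eq) (lookup-erase₂ j≢x j≢y ψ))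

  agree⇒erase₂-≡ : ∀ x y (φ ψ : Vec X n) → (∀ j → j ≢ x → j ≢ y → lookup φ j ≡ lookup ψ j) →
                   erase₂ x y φ ≡ erase₂ x y ψ
  agree⇒erase₂-≡ x y φ ψ agree = agree⇒erase₁-≡ y _ _ pointwise
    where
    pointwise : ∀ j → j ≢ y → lookup (erase₁ x φ) j ≡ lookup (erase₁ x ψ) j
    pointwise j j≢y with j ≟ x
    ... | yes refl = trans (lookup∘update j φ c₀) (sym (lookup∘update j ψ c₀))
    ... | no j≢x   = trans (lookup-erase₁ j≢x φ) (trans (agree j j≢x j≢y) (sym (lookup-erase₁ j≢x ψ)))

  ∑-fibre₁ : ∀ n (x : Fin n) (ψ : Vec X n) (f : Vec X n → ℕ) →
    ∑[ φ ∈ allVecs n E ] (if does (erase₁ x φ ≟V erase₁ x ψ) then f φ else 0) ≡ ∑[ a ∈ E ] f (ψ [ x ]≔ a)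
  ∑-fibre₁ (suc n) zero (c ∷ ψ) f = trans (∑-allVecs-suc n E _) (∑-cong E (λ e →
    trans (∑-cong (allVecs n E) (λ φ → cong (λ b → if b ∧ does (φ ≟V ψ) then f (e ∷ φ) else 0) (dec-true (c₀ ≟X c₀) refl)))
          (allVecs-enumerates _≟X_ E enum n ψ (f ∘ (e ∷_)))))
  ∑-fibre₁ (suc n) (suc x) (c ∷ ψ) f = begin
    ∑[ φ ∈ allVecs (suc n) E ] (if does (erase₁ (suc x) φ ≟V erase₁ (suc x) (c ∷ ψ)) then f φ else 0)
      ≡⟨ ∑-allVecs-suc n E _ ⟩
    ∑[ e ∈ E ] ∑[ φ ∈ allVecs n E ] (if does (e ≟X c) ∧ does (erase₁ x φ ≟V erase₁ x ψ) then f (e ∷ φ) else 0)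
      ≡⟨ ∑-cong E (λ e → trans (∑-cong (allVecs n E) (λ φ → if-∧ (does (e ≟X c)))) (∑-if (allVecs n E) (does (e ≟X c)) _)) ⟩
    ∑[ e ∈ E ] (if does (e ≟X c) then ∑[ φ ∈ allVecs n E ] (if does (erase₁ x φ ≟V erase₁ x ψ) then f (e ∷ φ) else 0) else 0)
      ≡⟨ enum c _ ⟩
    ∑[ φ ∈ allVecs n E ] (if does (erase₁ x φ ≟V erase₁ x ψ) then f (c ∷ φ) else 0)
      ≡⟨ ∑-fibre₁ n x ψ (f ∘ (c ∷_)) ⟩
    ∑[ a ∈ E ] f (c ∷ ψ [ x ]≔ a) ∎
    where open ≡-Reasoning

  erase₁-update-split : ∀ {x y : Fin n} → x ≢ y → ∀ (φ ψ : Vec X n) b →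
    does (erase₁ x φ ≟V erase₁ x (ψ [ y ]≔ b)) ≡ does (b ≟X lookup φ y) ∧ does (erase₂ x y φ ≟V erase₂ x y ψ)
  erase₁-update-split {x = x} {y} x≢y φ ψ b = true-iff ⇒ ⇐
    where
    ⇒ : does (erase₁ x φ ≟V erase₁ x (ψ [ y ]≔ b)) ≡ true →
        does (b ≟X lookup φ y) ∧ does (erase₂ x y φ ≟V erase₂ x y ψ) ≡ true
    ⇒ h = cong₂ _∧_ (dec-true (b ≟X lookup φ y) (sym (trans (agree y (x≢y ∘ sym)) (lookup∘update y ψ b))))
                    (dec-true (_ ≟V _) (agree⇒erase₂-≡ x y φ ψ λ j j≢x j≢y →
                                          trans (agree j j≢x) (lookup∘update′ j≢y ψ b)))
      where agree = erase₁-≡⇒agree x φ (ψ [ y ]≔ b) (does-sound (_ ≟V _) h)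
    ⇐ : does (b ≟X lookup φ y) ∧ does (erase₂ x y φ ≟V erase₂ x y ψ) ≡ true →
        does (erase₁ x φ ≟V erase₁ x (ψ [ y ]≔ b)) ≡ true
    ⇐ h = dec-true (_ ≟V _) (agree⇒erase₁-≡ x φ (ψ [ y ]≔ b) pointwise)
      where
      b≡φy = does-sound (b ≟X lookup φ y) (∧-conicalˡ _ _ h)
      agree = erase₂-≡⇒agree x y φ ψ (does-sound (_ ≟V _) (∧-conicalʳ _ _ h))
      pointwise : ∀ j → j ≢ x → lookup φ j ≡ lookup (ψ [ y ]≔ b) j
      pointwise j j≢x with j ≟ y
      ... | yes refl = trans (sym b≡φy) (sym (lookup∘update j ψ b))
      ... | no j≢y   = trans (agree j j≢x j≢y) (sym (lookup∘update′ j≢y ψ b))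

  ∑-fibre₂ : ∀ n {x y : Fin n} → x ≢ y → (ψ : Vec X n) (f : Vec X n → ℕ) →
    ∑[ φ ∈ allVecs n E ] (if does (erase₂ x y φ ≟V erase₂ x y ψ) then f φ else 0)
      ≡ ∑[ b ∈ E ] ∑[ a ∈ E ] f ((ψ [ y ]≔ b) [ x ]≔ a)
  ∑-fibre₂ n {x} {y} x≢y ψ f = begin
    ∑[ φ ∈ allVecs n E ] g φ
      ≡⟨ ∑-cong (allVecs n E) (λ φ → sym (enum (lookup φ y) (λ _ → g φ))) ⟩
    ∑[ φ ∈ allVecs n E ] ∑[ b ∈ E ] (if does (b ≟X lookup φ y) then g φ else 0)
      ≡⟨ ∑-cong (allVecs n E) (λ φ → ∑-cong E (λ b → trans (sym (if-∧ (does (b ≟X lookup φ y))))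
                                                            (cong (λ c → if c then f φ else 0) (sym (erase₁-update-split x≢y φ ψ b))))) ⟩
    ∑[ φ ∈ allVecs n E ] ∑[ b ∈ E ] (if does (erase₁ x φ ≟V erase₁ x (ψ [ y ]≔ b)) then f φ else 0)
      ≡⟨ ∑-comm (allVecs n E) E _ ⟩
    ∑[ b ∈ E ] ∑[ φ ∈ allVecs n E ] (if does (erase₁ x φ ≟V erase₁ x (ψ [ y ]≔ b)) then f φ else 0)
      ≡⟨ ∑-cong E (λ b → ∑-fibre₁ n x (ψ [ y ]≔ b) f) ⟩
    ∑[ b ∈ E ] ∑[ a ∈ E ] f ((ψ [ y ]≔ b) [ x ]≔ a) ∎
    where
    open ≡-Reasoning
    g : Vec X n → ℕ
    g φ = if does (erase₂ x y φ ≟V erase₂ x y ψ) then f φ else 0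

n≤2^⌈log₂n⌉ : ∀ n → n ≤ 2 ^ ⌈log₂ n ⌉
n≤2^⌈log₂n⌉ = <-rec _ bound
  where
  bound : ∀ n → (∀ {k} → k < n → k ≤ 2 ^ ⌈log₂ k ⌉) → n ≤ 2 ^ ⌈log₂ n ⌉
  bound zero          _  = z≤n
  bound (suc zero)    _  = s≤s z≤n
  bound n@(suc (suc k)) ih = begin
    n                                   ≡⟨ ⌊n/2⌋+⌈n/2⌉≡n n ⟨
    ⌊ n /2⌋ + ⌈ n /2⌉                   ≤⟨ +-monoˡ-≤ ⌈ n /2⌉ (⌊n/2⌋≤⌈n/2⌉ n) ⟩
    ⌈ n /2⌉ + ⌈ n /2⌉                   ≤⟨ +-mono-≤ half half ⟩
    2 ^ ⌈log₂ ⌈ n /2⌉ ⌉ + 2 ^ ⌈log₂ ⌈ n /2⌉ ⌉ ≡⟨ cong (2 ^ ⌈log₂ ⌈ n /2⌉ ⌉ +_) (+-identityʳ _) ⟨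
    2 ^ suc ⌈log₂ ⌈ n /2⌉ ⌉             ≡⟨ cong (λ e → 2 ^ suc e) (⌈log₂⌈n/2⌉⌉≡⌈log₂n⌉∸1 n) ⟩
    2 ^ suc (⌈log₂ n ⌉ ∸ 1)             ≡⟨ cong (2 ^_) (suc[k∸1]≡k (⌈log₂⌉-mono-≤ {2} {n} (s≤s (s≤s z≤n)))) ⟩
    2 ^ ⌈log₂ n ⌉                       ∎
    where
    open ≤-Reasoning
    half : ⌈ n /2⌉ ≤ 2 ^ ⌈log₂ ⌈ n /2⌉ ⌉
    half = ih (⌈n/2⌉<n k)
    suc[k∸1]≡k : ∀ {k} → 1 ≤ k → suc (k ∸ 1) ≡ k
    suc[k∸1]≡k (s≤s _) = refl

map-↣ : A ↣ B → Vec A n ↣ Vec B n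
map-↣ f = mk↣ (injective-map _ _)
  where
  open Injection f using (to; injective)
  injective-map : ∀ {n} (xs ys : Vec _ n) → Vec.map to xs ≡ Vec.map to ys → xs ≡ ys
  injective-map []       []       _  = refl
  injective-map (x ∷ xs) (y ∷ ys) eq =
    let x≡y , xs≡ys = ∷-injective eq in cong₂ _∷_ (injective x≡y) (injective-map xs ys xs≡ys)

binary : ∀ w → Fin (2 ^ w) ↣ Vec Bool w
binary w = map-↣ (↔⇒↣ 2↔Bool) ↣-∘ ↔⇒↣ (↔Vec w ↔-∘ Fin[m^n]↔Fin[m]^n 2 w)

code : ∀ m → Fin m ↣ Vec Bool ⌈log₂ m ⌉
code m = binary ⌈log₂ m ⌉ ↣-∘ mk↣ (inject≤-injective (n≤2^⌈log₂n⌉ m) (n≤2^⌈log₂n⌉ m) _ _)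

concat-injective : (xss yss : Vec (Vec A w) r) → concat xss ≡ concat yss → xss ≡ yss
concat-injective []         []         _  = refl
concat-injective (xs ∷ xss) (ys ∷ yss) eq =
  cong₂ _∷_ (++-injectiveˡ xs ys eq) (concat-injective xss yss (++-injectiveʳ xs ys eq))

blocks : ∀ r → Vec A (r * w) → Vec (Vec A w) r
blocks r s = proj₁ (group r _ s)

blocks-concat : (xss : Vec (Vec A w) r) → blocks r (concat xss) ≡ xss
blocks-concat {r = r} xss = sym (concat-injective _ _ (proj₂ (group r _ (concat xss))))

apartᵇ : DecidableEquality A → Vec A r → Vec A r → Bool
apartᵇ _≟A_ a b = allᶠ (λ i → not (does (lookup a i ≟A lookup b i)))

apartᵇ-sound : (_≟A_ : DecidableEquality A) (a b : Vec A r) → apartᵇ _≟A_ a b ≡ true → ∀ i → lookup a i ≢ lookup b i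
apartᵇ-sound _≟A_ a b apart i eq with allᶠ-elim _ apart i
... | differ rewrite dec-true (lookup a i ≟A lookup b i) eq with () ← differ

apartᵇ-complete : (_≟A_ : DecidableEquality A) (a b : Vec A r) → (∀ i → lookup a i ≢ lookup b i) → apartᵇ _≟A_ a b ≡ true
apartᵇ-complete _≟A_ a b a≢b = allᶠ-intro _ (λ i → cong not (dec-false (_ ≟A _) (a≢b i)))

apartᵇ-sym : (_≟A_ : DecidableEquality A) (a b : Vec A r) → apartᵇ _≟A_ a b ≡ apartᵇ _≟A_ b a
apartᵇ-sym _≟A_ a b = allᶠ-cong (λ i → cong not (does-≟-sym _≟A_ (lookup a i) (lookup b i)))

apartᵇ-map : (_≟A_ : DecidableEquality A) (_≟B_ : DecidableEquality B) (f : A ↣ B) (a b : Vec A r) →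
             apartᵇ _≟B_ (Vec.map (Injection.to f) a) (Vec.map (Injection.to f) b) ≡ apartᵇ _≟A_ a b
apartᵇ-map _≟A_ _≟B_ f a b = allᶠ-cong pointwise
  where
  open Injection f using (to; injective)
  pointwise : ∀ i → not (does (lookup (Vec.map to a) i ≟B lookup (Vec.map to b) i)) ≡ not (does (lookup a i ≟A lookup b i))
  pointwise i rewrite lookup-map i to a | lookup-map i to b with lookup a i ≟A lookup b i
  ... | yes α≡β  = cong not (dec-true (_ ≟B _) (cong to α≡β))
  ... | no α≢β   = cong not (dec-false (_ ≟B _) (α≢β ∘ injective))

encode : ∀ {m r} → Vec (Fin m) r → Vec Bool (r * ⌈log₂ m ⌉)
encode {m} a = concat (Vec.map (Injection.to (code m)) a)

decode : ∀ r w → Vec Bool (r * w) → Vec Bool (r * w) → Bool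
decode r w s t = apartᵇ (≡-dec Bool._≟_) (blocks r s) (blocks r t)

decode-encode : ∀ {m r} (a b : Vec (Fin m) r) → decode r ⌈log₂ m ⌉ (encode a) (encode b) ≡ apartᵇ _≟_ a b
decode-encode {m} a b rewrite blocks-concat (Vec.map (Injection.to (code m)) a) | blocks-concat (Vec.map (Injection.to (code m)) b) =
  apartᵇ-map _≟_ (≡-dec Bool._≟_) (code m) a b

run-query : (ℓ : Fin n → Label c) (x : Fin n) (k : Label c → Adversary n c) →
            run ℓ (query x k) ≡ (x ∷ proj₁ (run ℓ (k (ℓ x))) , proj₂ (run ℓ (k (ℓ x))))
run-query ℓ x k with run ℓ (k (ℓ x))
... | qs , pair = refl

∈ᵇ-here : (x : Fin n) (qs : List (Fin n)) → x ∈ᵇ (x ∷ qs) ≡ true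
∈ᵇ-here x qs = cong (_∨ (x ∈ᵇ qs)) (trans (isYes≗does (x ≟ x)) (dec-true (x ≟ x) refl))

∈ᵇ-there : (q x : Fin n) (qs : List (Fin n)) → q ∈ᵇ qs ≡ true → q ∈ᵇ (x ∷ qs) ≡ true
∈ᵇ-there q x qs q∈qs = trans (cong (⌊ q ≟ x ⌋ ∨_) q∈qs) (∨-zeroʳ _)

run-cong : (ℓ ℓ′ : Fin n → Label c) (A : Adversary n c) →
           (∀ q → q ∈ᵇ proj₁ (run ℓ A) ≡ true → ℓ′ q ≡ ℓ q) → run ℓ′ A ≡ run ℓ A
run-cong ℓ ℓ′ (guess x y) _ = refl
run-cong ℓ ℓ′ (query x k) agree
  rewrite run-query ℓ x k | run-query ℓ′ x k | agree x (∈ᵇ-here x (proj₁ (run ℓ (k (ℓ x))))) =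
  cong (λ R → x ∷ proj₁ R , proj₂ R) (run-cong ℓ ℓ′ (k (ℓ x)) λ q → agree q ∘ ∈ᵇ-there q x (proj₁ (run ℓ (k (ℓ x)))))

legalᵇ : Graph n → List (Fin n) → Fin n → Fin n → Bool
legalᵇ {n} G qs x y = ((length qs + 2) ≤ᵇ n) ∧ not ⌊ x ≟ y ⌋ ∧ not (x ∈ᵇ qs) ∧ not (y ∈ᵇ qs) ∧ not (adj G x y)

wins-≡ : (G : Graph n) (D : Decoder c) (ℓ : Fin n → Label c) (A : Adversary n c) {qs : List (Fin n)} {x y : Fin n} →
         run ℓ A ≡ (qs , (x , y)) → wins G D ℓ A ≡ legalᵇ G qs x y ∧ D (ℓ x) (ℓ y)
wins-≡ {n} G D ℓ A {qs} {x} {y} eq rewrite eq =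
  sym (trans (∧-assoc a₁ _ _) (cong (a₁ ∧_)
      (trans (∧-assoc a₂ _ _) (cong (a₂ ∧_) (trans (∧-assoc a₃ _ _) (cong (a₃ ∧_) (∧-assoc a₄ _ _)))))))
  where
  a₁ = (length qs + 2) ≤ᵇ n
  a₂ = not ⌊ x ≟ y ⌋
  a₃ = not (x ∈ᵇ qs)
  a₄ = not (y ∈ᵇ qs)

record Legal (G : Graph n) (qs : List (Fin n)) (x y : Fin n) : Set where
  field
    distinct     : x ≢ y
    non-adjacent : adj G x y ≡ false
    x-unqueried  : x ∈ᵇ qs ≡ false
    y-unqueried  : y ∈ᵇ qs ≡ false

legalᵇ-sound : (G : Graph n) (qs : List (Fin n)) (x y : Fin n) → legalᵇ G qs x y ≡ true → Legal G qs x y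
legalᵇ-sound {n} G qs x y legal with (length qs + 2) ≤ᵇ n | x ≟ y | x ∈ᵇ qs in x∉qs | y ∈ᵇ qs in y∉qs | adj G x y in x≁y
legalᵇ-sound G qs x y ()    | false | _      | _     | _     | _
legalᵇ-sound G qs x y ()    | true  | yes _  | _     | _     | _
legalᵇ-sound G qs x y ()    | true  | no _   | true  | _     | _
legalᵇ-sound G qs x y ()    | true  | no _   | false | true  | _
legalᵇ-sound G qs x y ()    | true  | no _   | false | false | true
legalᵇ-sound G qs x y refl  | true  | no x≢y | false | false | false = record
  { distinct = x≢y ; non-adjacent = x≁y ; x-unqueried = x∉qs ; y-unqueried = y∉qs }

avoidsᵇ : (Fin n → Bool) → (Fin n → Fin m) → Fin m → Bool
avoidsᵇ q f α = allᶠ (λ v → not (q v) ∨ f v ≢ᵇ α)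

avoidsᵇ-sound : (q : Fin n → Bool) (f : Fin n → Fin m) {α : Fin m} → avoidsᵇ q f α ≡ true →
                ∀ v → q v ≡ true → f v ≢ α
avoidsᵇ-sound q f {α} avoids v qv fv≡α with allᶠ-elim _ avoids v
... | hit rewrite qv | dec-true (f v ≟ α) fv≡α with () ← hit

avoidsᵇ-complete : (q : Fin n → Bool) (f : Fin n → Fin m) {α : Fin m} → (∀ v → q v ≡ true → f v ≢ α) →
                   avoidsᵇ q f α ≡ true
avoidsᵇ-complete q f {α} avoids = allᶠ-intro _ pointwise
  where
  pointwise : ∀ v → not (q v) ∨ f v ≢ᵇ α ≡ true
  pointwise v with q v in qv
  ... | true  = cong not (dec-false (f v ≟ α) (avoids v qv))
  ... | false = refl

count-blocked≤ : (q : Fin n → Bool) (f : Fin n → Fin m) → countᶠ (not ∘ avoidsᵇ q f) ≤ countᶠ q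
count-blocked≤ {m = m} q f = subst (_≤ countᶠ q) (count-allFin m (not ∘ avoidsᵇ q f)) (blocked q f)
  where
  blocked : ∀ {n} (q : Fin n → Bool) (f : Fin n → Fin m) → count (not ∘ avoidsᵇ q f) (allFin m) ≤ countᶠ q
  blocked {zero}  q f = ≤-reflexive (∑-zero (allFin m))
  blocked {suc n} q f = begin
    count (λ α → not (X α ∧ Y α)) (allFin m)                 ≤⟨ ∑-mono-≤ (allFin m) (λ α → ⟦not∧⟧ (X α) (Y α)) ⟩
    ∑[ α ∈ allFin m ] (⟦ not (X α) ⟧ + ⟦ not (Y α) ⟧)        ≡⟨ ∑-distrib-+ (allFin m) _ _ ⟩
    count (not ∘ X) (allFin m) + count (not ∘ Y) (allFin m)
      ≤⟨ +-mono-≤ (≤-reflexive (blocked-by-zero (q zero) refl)) (blocked (q ∘ suc) (f ∘ suc)) ⟩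
    ⟦ q zero ⟧ + countᶠ (q ∘ suc)                            ∎
    where
    open ≤-Reasoning
    X Y : Fin m → Bool
    X α = not (q zero) ∨ f zero ≢ᵇ α
    Y   = avoidsᵇ (q ∘ suc) (f ∘ suc)
    ⟦not∧⟧ : ∀ a b → ⟦ not (a ∧ b) ⟧ ≤ ⟦ not a ⟧ + ⟦ not b ⟧
    ⟦not∧⟧ true  b = ≤-refl
    ⟦not∧⟧ false b = s≤s z≤n
    blocked-by-zero : ∀ b → q zero ≡ b → count (not ∘ X) (allFin m) ≡ ⟦ b ⟧
    blocked-by-zero false q0 rewrite q0 = ∑-zero (allFin m)
    blocked-by-zero true  q0 rewrite q0 =
      trans (∑-cong (allFin m) (λ α → cong (λ b → ⟦ b ⟧) (trans (not-involutive _) (does-≟-sym _≟_ (f zero) α))))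
            (allFin-enumerates m (f zero) (const 1))

avoidsᵇ-exists : (q : Fin n → Bool) (f : Fin n → Fin m) → countᶠ q < m → ∃ λ α → avoidsᵇ q f α ≡ true
avoidsᵇ-exists {m = m} q f q<m = countᶠ-witness (avoidsᵇ q f) (+-cancelˡ-< (countᶠ (not ∘ avoidsᵇ q f)) 0 _ (begin-strict
  countᶠ (not ∘ avoidsᵇ q f) + 0                              ≤⟨ +-monoˡ-≤ 0 (count-blocked≤ q f) ⟩
  countᶠ q + 0                                                 <⟨ +-monoˡ-< 0 q<m ⟩
  m + 0                                                        ≡⟨ +-identityʳ m ⟩
  m                                                            ≡⟨ countᶠ-not+countᶠ (avoidsᵇ q f) ⟨
  countᶠ (not ∘ avoidsᵇ q f) + countᶠ (avoidsᵇ q f)           ∎))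
  where open ≤-Reasoning

proper-colouring : (G : Graph n) → MaxDeg≤ d G → d < m →
                   ∃ λ (g : Fin n → Fin m) → ∀ u v → adj G u v ≡ true → g u ≢ g v
proper-colouring {n} {d} {m} G Δ≤d d<m =
  let g , proper = greedy n ≤-refl in g , λ u v uv → proper u v uv (toℕ<n u) (toℕ<n v)
  where
  ProperBelow : ℕ → (Fin n → Fin m) → Set
  ProperBelow k g = ∀ u v → adj G u v ≡ true → toℕ u < k → toℕ v < k → g u ≢ g v

  greedy : ∀ k → k ≤ n → ∃ (ProperBelow k)
  greedy zero    _   = (λ _ → fromℕ< d<m) , λ _ _ _ ()
  greedy (suc k) k<n = g′ , proper′
    where
    g = proj₁ (greedy k (<⇒≤ k<n))
    z = fromℕ< k<n
    earlier : Fin n → Bool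
    earlier v = adj G z v ∧ (toℕ v <ᵇ k)
    earlier≤d : countᶠ earlier ≤ d
    earlier≤d = ≤-trans (countᶠ-mono {p = earlier} {q = adj G z} (λ v → ∧-conicalˡ (adj G z v) _)) (Δ≤d z)
    free = avoidsᵇ-exists earlier g (≤-<-trans earlier≤d d<m)
    α = proj₁ free
    g′ : Fin n → Fin m
    g′ u = if does (u ≟ z) then α else g u
    below-k : ∀ u → toℕ u < suc k → u ≢ z → toℕ u < k
    below-k u u<1+k u≢z = ≤∧≢⇒< (≤-pred u<1+k) (λ u≡k → u≢z (toℕ-injective (trans u≡k (sym (toℕ-fromℕ< k<n)))))
    earlier-neighbour : ∀ v → adj G z v ≡ true → toℕ v < k → earlier v ≡ true
    earlier-neighbour v zv v<k rewrite zv = Equivalence.to T-≡ (<⇒<ᵇ v<k)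
    α-fresh : ∀ v → adj G z v ≡ true → toℕ v < k → g v ≢ α
    α-fresh v zv v<k = avoidsᵇ-sound earlier g (proj₂ free) v (earlier-neighbour v zv v<k)
    proper′ : ProperBelow (suc k) g′
    proper′ u v uv u<1+k v<1+k with u ≟ z | v ≟ z
    ... | yes refl | yes refl with () ← trans (sym uv) (irrefl G u)
    ... | yes refl | no v≢z   = λ α≡gv → α-fresh v uv (below-k v v<1+k v≢z) (sym α≡gv)
    ... | no u≢z   | yes refl = α-fresh u (trans (Graph.sym G v u) uv) (below-k u u<1+k u≢z)
    ... | no u≢z   | no v≢z   = proj₂ (greedy k (<⇒≤ k<n)) u v uv (below-k u u<1+k u≢z) (below-k v v<1+k v≢z)

-- The labeling scheme

module Construction (d : ℕ) where

  colours coords width : ℕ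
  colours = suc (4 * d)
  coords  = suc (colours + 4 * d)
  width   = ⌈log₂ colours ⌉

  Column : Set
  Column = Vec (Fin colours) coords

  Columns : List Column
  Columns = allVecs coords (allFin colours)

  allColourings : ∀ n → List (Vec Column n)
  allColourings n = allVecs n Columns

  _≟C_ : DecidableEquality Column
  _≟C_ = ≡-dec _≟_

  c₀ : Column
  c₀ = replicate coords zero

  Columns-enumerates : Enumerates _≟C_ Columns
  Columns-enumerates = allVecs-enumerates _≟_ (allFin colours) (allFin-enumerates colours) coords

  open Fibres _≟C_ Columns Columns-enumerates c₀ public

  apart : Column → Column → Bool
  apart = apartᵇ _≟_

  module _ {n} (G : Graph n) where

    properᵇ : Vec Column n → Bool
    properᵇ φ = allᶠ (λ u → allᶠ (λ v → not (adj G u v) ∨ apart (lookup φ u) (lookup φ v)))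

    Proper : Vec Column n → Set
    Proper φ = ∀ u v → adj G u v ≡ true → apart (lookup φ u) (lookup φ v) ≡ true

    properᵇ-sound : ∀ φ → properᵇ φ ≡ true → Proper φ
    properᵇ-sound φ proper u v uv with allᶠ-elim _ (allᶠ-elim _ proper u) v
    ... | apart-uv rewrite uv = apart-uv

    properᵇ-complete : ∀ φ → Proper φ → properᵇ φ ≡ true
    properᵇ-complete φ proper = allᶠ-intro _ (λ u → allᶠ-intro _ (λ v → pointwise u v))
      where
      pointwise : ∀ u v → not (adj G u v) ∨ apart (lookup φ u) (lookup φ v) ≡ true
      pointwise u v with adj G u v in uv
      ... | true  = proper u v uv
      ... | false = refl

    colourings : List (Vec Column n)
    colourings = filterᵇ properᵇ (allColourings n)

  module _ {n} (G : Graph n) (Δ≤d : MaxDeg≤ d G) where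

    colouring : ∃ λ (g : Fin n → Fin colours) → ∀ u v → adj G u v ≡ true → g u ≢ g v
    colouring = proper-colouring G Δ≤d (s≤s (m≤n*m d 4))

    φ₀ : Vec Column n
    φ₀ = tabulate (λ v → replicate coords (proj₁ colouring v))

    φ₀-proper : properᵇ G φ₀ ≡ true
    φ₀-proper = properᵇ-complete G φ₀ λ u v uv →
      apartᵇ-complete _≟_ (lookup φ₀ u) (lookup φ₀ v) λ i same → proj₂ colouring u v uv (begin
        g u                                   ≡⟨ lookup-replicate i (g u) ⟨
        lookup (replicate coords (g u)) i     ≡⟨ cong (λ c → lookup c i) (lookup∘tabulate _ u) ⟨
        lookup (lookup φ₀ u) i                ≡⟨ same ⟩
        lookup (lookup φ₀ v) i                ≡⟨ cong (λ c → lookup c i) (lookup∘tabulate _ v) ⟩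
        lookup (replicate coords (g v)) i     ≡⟨ lookup-replicate i (g v) ⟩
        g v                                   ∎)
      where
      open ≡-Reasoning
      g = proj₁ colouring

    colourings-nonempty : 1 ≤ length (colourings G)
    colourings-nonempty = begin
      1
        ≡⟨ cong ⟦_⟧ φ₀-proper ⟨
      ⟦ properᵇ G φ₀ ⟧
        ≡⟨ allVecs-enumerates _≟C_ Columns Columns-enumerates n φ₀ (⟦_⟧ ∘ properᵇ G) ⟨
      ∑[ φ ∈ allColourings n ] (if does (φ ≟V φ₀) then ⟦ properᵇ G φ ⟧ else 0)
        ≤⟨ ∑-mono-≤ (allColourings n) (λ φ → if≤ (does (φ ≟V φ₀))) ⟩
      count (properᵇ G) (allColourings n)
        ≡⟨ length-filterᵇ (properᵇ G) (allColourings n) ⟨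
      length (colourings G) ∎
      where
      open ≤-Reasoning
      if≤ : ∀ b {k} → (if b then k else 0) ≤ k
      if≤ true  = ≤-refl
      if≤ false = z≤n

  label : ∀ {n} → Vec Column n → Fin n → Label (coords * width)
  label φ v = encode (lookup φ v)

  D : Decoder (coords * width)
  D = decode coords width

  module _ {n} (G : Graph n) (A : Adversary n (coords * width)) where

    winning : Vec Column n → Bool
    winning φ = wins G (D) (label φ) A

    Key : Set
    Key = Fin n × Fin n × Vec Column n

    key-of : List (Fin n) × (Fin n × Fin n) → Vec Column n → Key
    key-of (_ , (x , y)) φ = x , y , erase₂ x y φ

    key : Vec Column n → Key
    key φ = key-of (run (label φ) A) φ

    key-of-≡ : ∀ R φ {x y V} → key-of R φ ≡ (x , y , V) → erase₂ x y φ ≡ V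
    key-of-≡ (_ , (x , y)) φ refl = refl

    _≟K_ : DecidableEquality Key
    _≟K_ = Product.≡-dec _≟_ (Product.≡-dec _≟_ _≟V_)

    open Classes _≟K_ key

    module WinningClass (Δ≤d : MaxDeg≤ d G) (φ* : Vec Column n) (proper* : properᵇ G φ* ≡ true) (wins* : winning φ* ≡ true)
                 {qs x y} (run* : run (label φ*) A ≡ (qs , (x , y))) where

      legal* : legalᵇ G qs x y ≡ true
      legal* = ∧-conicalˡ _ _ (trans (sym (wins-≡ G (D) (label φ*) A run*)) wins*)

      open Legal (legalᵇ-sound G qs x y legal*)

      in-fibre : Vec Column n → Bool
      in-fibre φ = does (erase₂ x y φ ≟V erase₂ x y φ*)

      run-in-fibre : ∀ φ → in-fibre φ ≡ true → run (label φ) A ≡ (qs , (x , y))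
      run-in-fibre φ in-φ = trans (run-cong (label φ*) (label φ) A queried-agree) run*
        where
        queried-agree : ∀ q → q ∈ᵇ proj₁ (run (label φ*) A) ≡ true → label φ q ≡ label φ* q
        queried-agree q q∈ =
          cong encode (erase₂-≡⇒agree x y φ φ* (does-sound (_ ≟V _) in-φ) q (≢-unqueried x-unqueried) (≢-unqueried y-unqueried))
          where
          q∈qs : q ∈ᵇ qs ≡ true
          q∈qs = subst (λ R → q ∈ᵇ proj₁ R ≡ true) run* q∈
          ≢-unqueried : ∀ {z} → z ∈ᵇ qs ≡ false → q ≢ z
          ≢-unqueried z∉ refl with () ← trans (sym q∈qs) z∉

      key* : key φ* ≡ (x , y , erase₂ x y φ*)
      key* = cong (λ R → key-of R φ*) run*

      class-is-fibre : ∀ φ → φ* ∼ᵇ φ ≡ in-fibre φ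
      class-is-fibre φ = true-iff ⇒ ⇐
        where
        ⇒ : φ* ∼ᵇ φ ≡ true → in-fibre φ ≡ true
        ⇒ same = dec-true (_ ≟V _) (key-of-≡ (run (label φ) A) φ (trans (sym (does-sound (_ ≟K _) same)) key*))

        ⇐ : in-fibre φ ≡ true → φ* ∼ᵇ φ ≡ true
        ⇐ in-φ = dec-true (key φ* ≟K key φ) (trans key* (sym (trans (cong (λ R → key-of R φ) (run-in-fibre φ in-φ))
                                                   (cong (λ V → x , y , V) (does-sound (_ ≟V _) in-φ)))))

      wins-in-fibre : ∀ φ → in-fibre φ ≡ true → winning φ ≡ apart (lookup φ x) (lookup φ y)
      wins-in-fibre φ in-φ = begin
        winning φ                                                           ≡⟨ wins-≡ G D (label φ) A (run-in-fibre φ in-φ) ⟩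
        legalᵇ G qs x y ∧ D (label φ x) (label φ y)                        ≡⟨ cong (_∧ _) legal* ⟩
        D (encode (lookup φ x)) (encode (lookup φ y))                       ≡⟨ decode-encode (lookup φ x) (lookup φ y) ⟩
        apart (lookup φ x) (lookup φ y)                                      ∎
        where open ≡-Reasoning

      ψ : Column → Column → Vec Column n
      ψ a b = (φ* [ y ]≔ b) [ x ]≔ a

      ψ-x : ∀ a b → lookup (ψ a b) x ≡ a
      ψ-x a b = lookup∘update x (φ* [ y ]≔ b) a

      ψ-y : ∀ a b → lookup (ψ a b) y ≡ b
      ψ-y a b = trans (lookup∘update′ (distinct ∘ sym) (φ* [ y ]≔ b) a) (lookup∘update y φ* b)

      ψ-other : ∀ a b {j} → j ≢ x → j ≢ y → lookup (ψ a b) j ≡ lookup φ* j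
      ψ-other a b j≢x j≢y = trans (lookup∘update′ j≢x (φ* [ y ]≔ b) a) (lookup∘update′ j≢y φ* b)

      ψ-in-fibre : ∀ a b → in-fibre (ψ a b) ≡ true
      ψ-in-fibre a b = dec-true (_ ≟V _) (agree⇒erase₂-≡ x y (ψ a b) φ* (λ j → ψ-other a b))

      neighbour-off : ∀ {z v} → z ≡ x ⊎ z ≡ y → adj G z v ≡ true → v ≢ x × v ≢ y
      neighbour-off (inj₁ refl) xv =
        (λ { refl → conflict (irrefl G x) xv }) , (λ { refl → conflict non-adjacent xv })
      neighbour-off (inj₂ refl) yv =
        (λ { refl → conflict (trans (Graph.sym G y x) non-adjacent) yv }) , (λ { refl → conflict (irrefl G y) yv })

      φ*-at : Fin coords → Fin n → Fin colours
      φ*-at i v = lookup (lookup φ* v) i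

      allowed : Fin n → Fin coords → Fin colours → Bool
      allowed z i = avoidsᵇ (adj G z) (φ*-at i)

      okᵇ : Fin n → Column → Bool
      okᵇ z a = allᶠ (λ i → allowed z i (lookup a i))

      okᵇ-sound : ∀ z a → okᵇ z a ≡ true → ∀ v → adj G z v ≡ true → apart a (lookup φ* v) ≡ true
      okᵇ-sound z a ok v zv = apartᵇ-complete _≟_ a (lookup φ* v) λ i eq →
        avoidsᵇ-sound (adj G z) (φ*-at i) (allᶠ-elim (λ i → allowed z i (lookup a i)) ok i) v zv (sym eq)

      okᵇ-complete : ∀ z a → (∀ v → adj G z v ≡ true → apart a (lookup φ* v) ≡ true) → okᵇ z a ≡ true
      okᵇ-complete z a apart-nbrs =
        allᶠ-intro (λ i → allowed z i (lookup a i)) λ i → avoidsᵇ-complete (adj G z) (φ*-at i) λ v zv eq →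
          apartᵇ-sound _≟_ a (lookup φ* v) (apart-nbrs v zv) i (sym eq)

      -- Here it matters that x and y are not adjacent.
      proper-split : ∀ a b → properᵇ G (ψ a b) ≡ okᵇ x a ∧ okᵇ y b
      proper-split a b = true-iff ⇒ ⇐
        where
        ψ-at = lookup (ψ a b)

        ⇒ : properᵇ G (ψ a b) ≡ true → okᵇ x a ∧ okᵇ y b ≡ true
        ⇒ proper = cong₂ _∧_ (okᵇ-complete x a (subst (ApartFromNeighbours x) (ψ-x a b) (nbrs (inj₁ refl))))
                             (okᵇ-complete y b (subst (ApartFromNeighbours y) (ψ-y a b) (nbrs (inj₂ refl))))
          where
          ApartFromNeighbours : Fin n → Column → Set
          ApartFromNeighbours z c = ∀ v → adj G z v ≡ true → apart c (lookup φ* v) ≡ true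
          nbrs : ∀ {z} → z ≡ x ⊎ z ≡ y → ApartFromNeighbours z (ψ-at z)
          nbrs {z} z∈xy v zv = let v≢x , v≢y = neighbour-off z∈xy zv in
            subst (λ t → apart (ψ-at z) t ≡ true) (ψ-other a b v≢x v≢y) (properᵇ-sound G (ψ a b) proper z v zv)

        ⇐ : okᵇ x a ∧ okᵇ y b ≡ true → properᵇ G (ψ a b) ≡ true
        ⇐ ok = properᵇ-complete G (ψ a b) pointwise
          where
          nbrs : ∀ {z} → z ≡ x ⊎ z ≡ y → okᵇ z (ψ-at z) ≡ true →
                 ∀ v → adj G z v ≡ true → apart (ψ-at z) (ψ-at v) ≡ true
          nbrs {z} z∈xy ok-z v zv = let v≢x , v≢y = neighbour-off z∈xy zv in
            subst (λ t → apart (ψ-at z) t ≡ true) (sym (ψ-other a b v≢x v≢y)) (okᵇ-sound z (ψ-at z) ok-z v zv)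
          nbrs-x = nbrs (inj₁ refl) (subst (λ c → okᵇ x c ≡ true) (sym (ψ-x a b)) (∧-conicalˡ (okᵇ x a) (okᵇ y b) ok))
          nbrs-y = nbrs (inj₂ refl) (subst (λ c → okᵇ y c ≡ true) (sym (ψ-y a b)) (∧-conicalʳ (okᵇ x a) (okᵇ y b) ok))
          flip : ∀ u v → apart (ψ-at v) (ψ-at u) ≡ true → apart (ψ-at u) (ψ-at v) ≡ true
          flip u v = trans (apartᵇ-sym _≟_ (ψ-at u) (ψ-at v))
          pointwise : ∀ u v → adj G u v ≡ true → apart (ψ-at u) (ψ-at v) ≡ true
          pointwise u v uv with u ≟ x | u ≟ y | v ≟ x | v ≟ y
          ... | yes refl | _        | _        | _        = nbrs-x v uv
          ... | no _     | yes refl | _        | _        = nbrs-y v uv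
          ... | no _     | no _     | yes refl | _        = flip u v (nbrs-x u (trans (Graph.sym G v u) uv))
          ... | no _     | no _     | no _     | yes refl = flip u v (nbrs-y u (trans (Graph.sym G v u) uv))
          ... | no u≢x   | no u≢y   | no v≢x   | no v≢y   =
            subst₂ (λ s t → apart s t ≡ true) (sym (ψ-other a b u≢x u≢y)) (sym (ψ-other a b v≢x v≢y))
                   (properᵇ-sound G φ* proper* u v uv)

      count-class : (p : Vec Column n → Bool) →
        count (λ φ → p φ ∧ φ* ∼ᵇ φ) (allColourings n) ≡ ∑[ b ∈ Columns ] ∑[ a ∈ Columns ] ⟦ p (ψ a b) ⟧
      count-class p =
        trans (∑-cong (allColourings n) (λ φ → trans (cong (λ e → ⟦ p φ ∧ e ⟧) (class-is-fibre φ)) (⟦∧⟧-if (p φ) (in-fibre φ))))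
              (∑-fibre₂ n distinct φ* (⟦_⟧ ∘ p))

      allowed-large : ∀ z i → countᶠ (not ∘ allowed z i) ≤ d
      allowed-large z i = ≤-trans (count-blocked≤ (adj G z) (φ*-at i)) (Δ≤d z)

      fibre-half : 2 * count (λ φ → (properᵇ G φ ∧ winning φ) ∧ φ* ∼ᵇ φ) (allColourings n)
                     ≤ count (λ φ → properᵇ G φ ∧ φ* ∼ᵇ φ) (allColourings n)
      fibre-half = begin
        2 * count (λ φ → (properᵇ G φ ∧ winning φ) ∧ φ* ∼ᵇ φ) (allColourings n)
          ≡⟨ cong (2 *_) (trans (count-class (λ φ → properᵇ G φ ∧ winning φ)) (∑-comm Columns Columns _)) ⟩
        2 * ∑[ a ∈ Columns ] ∑[ b ∈ Columns ] ⟦ properᵇ G (ψ a b) ∧ winning (ψ a b) ⟧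
          ≡⟨ cong (2 *_) (∑-cong Columns (λ a → ∑-cong Columns (λ b → cong ⟦_⟧ (winning-shape a b)))) ⟩
        2 * count₂ (λ a b → allᶠ (λ i → (allowed x i (lookup a i) ∧ allowed y i (lookup b i)) ∧ lookup a i ≢ᵇ lookup b i)) Columns
          ≤⟨ distinct-everywhere-at-most-half (allowed x) (allowed y) (allowed-large x) (allowed-large y) (n≤1+n (4 * d)) ⟩
        count₂ (λ a b → allᶠ (λ i → allowed x i (lookup a i) ∧ allowed y i (lookup b i))) Columns
          ≡⟨ ∑-cong Columns (λ a → ∑-cong Columns (λ b → cong ⟦_⟧ (proper-shape a b))) ⟨
        ∑[ a ∈ Columns ] ∑[ b ∈ Columns ] ⟦ properᵇ G (ψ a b) ⟧
          ≡⟨ trans (count-class (properᵇ G)) (∑-comm Columns Columns _) ⟨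
        count (λ φ → properᵇ G φ ∧ φ* ∼ᵇ φ) (allColourings n) ∎
        where
        open ≤-Reasoning
        proper-shape : ∀ a b → properᵇ G (ψ a b) ≡ allᶠ (λ i → allowed x i (lookup a i) ∧ allowed y i (lookup b i))
        proper-shape a b = trans (proper-split a b) (allᶠ-∧ (λ i → allowed x i (lookup a i)) (λ i → allowed y i (lookup b i)))
        winning-shape : ∀ a b → properᵇ G (ψ a b) ∧ winning (ψ a b)
                                ≡ allᶠ (λ i → (allowed x i (lookup a i) ∧ allowed y i (lookup b i)) ∧ lookup a i ≢ᵇ lookup b i)
        winning-shape a b rewrite proper-shape a b | wins-in-fibre (ψ a b) (ψ-in-fibre a b) | ψ-x a b | ψ-y a b =
          allᶠ-∧ (λ i → allowed x i (lookup a i) ∧ allowed y i (lookup b i)) (λ i → lookup a i ≢ᵇ lookup b i)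

    classwise-half : MaxDeg≤ d G → ClasswiseHalf winning (colourings G)
    classwise-half Δ≤d φ₁ rewrite count-filterᵇ (properᵇ G) (λ φ → winning φ ∧ φ₁ ∼ᵇ φ) (allColourings n)
                            | count-filterᵇ (properᵇ G) (φ₁ ∼ᵇ_) (allColourings n)
      with count≡0⊎witness (λ φ → properᵇ G φ ∧ (winning φ ∧ φ₁ ∼ᵇ φ)) (allColourings n)
    ... | inj₁ no-winner rewrite no-winner = z≤n
    ... | inj₂ (φ* , winner) = from-run refl
      where
      proper* = ∧-conicalˡ (properᵇ G φ*) _ winner
      wins*   = ∧-conicalˡ (winning φ*) _ (∧-conicalʳ (properᵇ G φ*) _ winner)
      same-class : ∀ φ → φ* ∼ᵇ φ ≡ φ₁ ∼ᵇ φ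
      same-class φ = sym (∼ᵇ-transˡ φ (∧-conicalʳ (winning φ*) _ (∧-conicalʳ (properᵇ G φ*) _ winner)))
      from-run : ∀ {qs x y} → run (label φ*) A ≡ (qs , (x , y)) →
                 2 * count (λ φ → properᵇ G φ ∧ (winning φ ∧ φ₁ ∼ᵇ φ)) (allColourings n)
                   ≤ count (λ φ → properᵇ G φ ∧ φ₁ ∼ᵇ φ) (allColourings n)
      from-run run* = subst₂ _≤_
        (cong (2 *_) (count-cong (allColourings n) λ φ →
          trans (∧-assoc (properᵇ G φ) (winning φ) (φ* ∼ᵇ φ)) (cong (λ s → properᵇ G φ ∧ (winning φ ∧ s)) (same-class φ))))
        (count-cong (allColourings n) (λ φ → cong (properᵇ G φ ∧_) (same-class φ)))
        (WinningClass.fibre-half Δ≤d φ* proper* wins* run*)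

    forgery-half : MaxDeg≤ d G → 2 * count winning (colourings G) ≤ length (colourings G)
    forgery-half Δ≤d = classwise-half⇒half winning (colourings G) (classwise-half Δ≤d)

  encoder : Encoder (coords * width)
  encoder = record
    { seeds    = λ G → length (colourings G) ∸ 1
    ; labeling = λ G s → label (pick (colourings G) (replicate _ c₀) s)
    }

  scheme : Scheme d (coords * width)
  scheme = record { enc = encoder ; dec = D ; complete = complete ; forgery = forgery }
    where
    complete : ∀ {n} (G : Graph n) → MaxDeg≤ d G → ∀ s u v → adj G u v ≡ true →
               D (labeling encoder G s u) (labeling encoder G s v) ≡ true
    complete G Δ≤d s u v uv with pick-lookup (colourings G) (replicate _ c₀) (colourings-nonempty G Δ≤d) s
    ... | i , picked rewrite picked =
      trans (decode-encode (lookup φ u) (lookup φ v)) (properᵇ-sound G φ (lookup-filterᵇ (properᵇ G) (allColourings _) i) u v uv)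
      where φ = List.lookup (colourings G) i

    forgery : ∀ {n} (G : Graph n) → MaxDeg≤ d G → (A : Adversary n (coords * width)) →
              2 * countᶠ (λ s → wins G D (labeling encoder G s) A) ≤ suc (length (colourings G) ∸ 1)
    forgery G Δ≤d A = begin
      2 * countᶠ (winning G A ∘ pick (colourings G) (replicate _ c₀))
        ≡⟨ cong (2 *_) (countᶠ-pick (winning G A) (colourings G) _ nonempty) ⟩
      2 * count (winning G A) (colourings G)
        ≤⟨ forgery-half G A Δ≤d ⟩
      length (colourings G)
        ≡⟨ suc-pred-length (colourings G) nonempty ⟨
      suc (length (colourings G) ∸ 1) ∎
      where
      open ≤-Reasoning
      nonempty = colourings-nonempty G Δ≤d

label-size : ∀ d → 2 ≤ d → Construction.coords d * Construction.width d ≤ 36 * (d * ⌈log₂ d ⌉)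
label-size d 2≤d = begin
  coords * width    ≤⟨ *-mono-≤ coords≤9d width≤4L ⟩
  9 * d * (4 * L)   ≡⟨ regroup d L ⟩
  36 * (d * L)      ∎
  where
  open ≤-Reasoning
  open Construction d using (colours; coords; width)
  L = ⌈log₂ d ⌉
  1≤d : 1 ≤ d
  1≤d = ≤-trans (s≤s z≤n) 2≤d
  1≤L : 1 ≤ L
  1≤L = ⌈log₂⌉-mono-≤ {2} {d} 2≤d
  regroup : ∀ d L → 9 * d * (4 * L) ≡ 36 * (d * L)
  regroup = solve-∀

  coords≤9d : coords ≤ 9 * d
  coords≤9d = subst₂ _≤_ (lhs d) (rhs d) (+-monoˡ-≤ (8 * d) 2≤d)
    where
    lhs : ∀ d → 2 + 8 * d ≡ suc (suc (4 * d) + 4 * d)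
    lhs = solve-∀
    rhs : ∀ d → d + 8 * d ≡ 9 * d
    rhs = solve-∀

  colours≤2^[3+L] : colours ≤ 2 ^ (3 + L)
  colours≤2^[3+L] = begin
    suc (4 * d)     ≤⟨ +-monoˡ-≤ (4 * d) (≤-trans (s≤s z≤n) (*-monoʳ-≤ 4 1≤d)) ⟩
    4 * d + 4 * d   ≡⟨ double d ⟩
    8 * d           ≤⟨ *-monoʳ-≤ 8 (n≤2^⌈log₂n⌉ d) ⟩
    2 ^ 3 * 2 ^ L   ≡⟨ ^-distribˡ-+-* 2 3 L ⟨
    2 ^ (3 + L)     ∎
    where
    double : ∀ x → 4 * x + 4 * x ≡ 8 * x
    double = solve-∀

  width≤4L : width ≤ 4 * L
  width≤4L = begin
    ⌈log₂ colours ⌉         ≤⟨ ⌈log₂⌉-mono-≤ colours≤2^[3+L] ⟩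
    ⌈log₂ (2 ^ (3 + L)) ⌉   ≡⟨ ⌈log₂2^n⌉≡n (3 + L) ⟩
    3 * 1 + L               ≤⟨ +-monoˡ-≤ L (*-monoʳ-≤ 3 1≤L) ⟩
    3 * L + L               ≡⟨ +-comm (3 * L) L ⟩
    4 * L                   ∎

claim3p5 : ∃[ C ] ∀ (d : ℕ) → ∃[ c ] ((2 ≤ d → c ≤ C * (d * ⌈log₂ d ⌉)) × Scheme d c)
claim3p5 = 36 , λ d → Construction.coords d * Construction.width d , label-size d , Construction.scheme d
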